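{- Let $k\ge3$ and for $n\ge0$ let $a(n)$ be the number of alternating permutations of length $n$ that avoid $1\mbox{ - }3\mbox{ - }2$ and contain $1\mbox{ - }2\mbox{ - }\cdots\mbox{ - }k$ exactly once. Then $$\sum_{n\ge0}a(n)x^n=\frac{1+x}{U_{k-1}^2\!\left(\frac1{2x}\right)}.$$
   Context: A permutation of length $n$ is a word $\pi_1\cdots\pi_n$ containing each of $1,\dots,n$ exactly once. A classical pattern $\tau$ of length $m$ (written with dashes) occurs in $\pi$ at indices $i_1<\dots<i_m$ if $\pi_{i_1}\cdots\pi_{i_m}$ is order-isomorphic to $\tau$; containing $\tau$ exactly $r$ times means there are exactly $r$ such index tuples, and avoiding means $r=0$. $1\mbox{ - }3\mbox{ - }2$ is $132$ and $1\mbox{ - }2\mbox{ - }\cdots\mbox{ - }k$ is $12\cdots k$. A permutation is alternating if $\pi_1<\pi_2>\pi_3<\pi_4>\cdots$ (i.e. $\pi_{2j-1}<\pi_{2j}$ and $\pi_{2j}>\pi_{2j+1}$ whenever indices are at most $n$); permutations of length $0$ and $1$ are alternating. $U_r$ is the Chebyshev polynomial of the second kind, $U_r(\cos\theta)=\sin((r+1)\theta)/\sin\theta$. -}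

module Defs where

open import Data.Bool using (Bool; true; false; _∧_; if_then_else_)
open import Data.Nat using (ℕ; zero; suc; _∸_; _≡ᵇ_; _<ᵇ_; _^_; _≤ᵇ_)
open import Data.List using (List; []; _∷_; [_]; map; concatMap; _++_; length; filterᵇ; applyUpTo; upTo; foldr)
open import Data.Integer using (ℤ; +_; _-_) renaming (_+_ to _+ℤ_; _*_ to _*ℤ_)

words : ℕ → ℕ → List (List ℕ)
words n zero    = [ [] ]
words n (suc l) = concatMap (λ w → map (λ a → a ∷ w) (applyUpTo suc n)) (words n l)

countLetter : ℕ → List ℕ → ℕ
countLetter i w = length (filterᵇ (λ a → i ≡ᵇ a) w)

allᵇ : (ℕ → Bool) → List ℕ → Bool
allᵇ p []       = true
allᵇ p (x ∷ xs) = p x ∧ allᵇ p xs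

isPermᵇ : ℕ → List ℕ → Bool
isPermᵇ n w = allᵇ (λ i → countLetter i w ≡ᵇ 1) (applyUpTo suc n)

perms : ℕ → List (List ℕ)
perms n = filterᵇ (isPermᵇ n) (words n n)

-- all subsequences of length m, one for each choice of indices i₁<…<iₘ
subseqs : ℕ → List ℕ → List (List ℕ)
subseqs zero    _        = [ [] ]
subseqs (suc m) []       = []
subseqs (suc m) (x ∷ xs) = map (x ∷_) (subseqs m xs) ++ subseqs (suc m) xs

_==_ : Bool → Bool → Bool
true  == b = b
false == true = false
false == false = true

agreeWith : ℕ → ℕ → List ℕ → List ℕ → Bool
agreeWith a b []        []        = true
agreeWith a b (a' ∷ u) (b' ∷ v) =
  ((a <ᵇ a') == (b <ᵇ b')) ∧ ((a' <ᵇ a) == (b' <ᵇ b)) ∧ agreeWith a b u v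
agreeWith a b _ _ = false

orderIsoᵇ : List ℕ → List ℕ → Bool
orderIsoᵇ []      []      = true
orderIsoᵇ (a ∷ u) (b ∷ v) = agreeWith a b u v ∧ orderIsoᵇ u v
orderIsoᵇ _ _ = false

occurrences : List ℕ → List ℕ → ℕ
occurrences τ π = length (filterᵇ (orderIsoᵇ τ) (subseqs (length τ) π))

mutual
  altUp : List ℕ → Bool
  altUp (a ∷ b ∷ rest) = (a <ᵇ b) ∧ altDown (b ∷ rest)
  altUp _ = true

  altDown : List ℕ → Bool
  altDown (a ∷ b ∷ rest) = (b <ᵇ a) ∧ altUp (b ∷ rest)
  altDown _ = true

isAlternating : List ℕ → Bool
isAlternating = altUp

pat132 : List ℕ
pat132 = 1 ∷ 3 ∷ 2 ∷ []

increasing : ℕ → List ℕ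
increasing k = applyUpTo suc k

a : ℕ → ℕ → ℕ
a k n = length (filterᵇ (λ π → isAlternating π ∧ (occurrences pat132 π ≡ᵇ 0)
                               ∧ (occurrences (increasing k) π ≡ᵇ 1))
                        (perms n))

Series : Set
Series = ℕ → ℤ

sumℤ : List ℤ → ℤ
sumℤ = foldr _+ℤ_ (+ 0)

_⊛_ : Series → Series → Series
(f ⊛ g) n = sumℤ (map (λ i → f i *ℤ g (n ∸ i)) (upTo (suc n)))

scale : ℤ → Series → Series
scale c f n = c *ℤ f n

xPow : ℕ → Series
xPow m n = if m ≡ᵇ n then + 1 else + 0

onePlusX : Series
onePlusX zero          = + 1
onePlusX (suc zero)    = + 1
onePlusX (suc (suc _)) = + 0

-- Chebyshev polynomials of the second kind, as coefficient functions in t: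
-- chebU r j = coefficient of t^j in U_r(t);  U₀ = 1, U₁ = 2t, U_{r+2} = 2t U_{r+1} − U_r.

shift2 : (ℕ → ℤ) → ℕ → ℤ
shift2 f zero    = + 0
shift2 f (suc j) = + 2 *ℤ f j

chebU : ℕ → ℕ → ℤ
chebU zero          j = if j ≡ᵇ 0 then + 1 else + 0
chebU (suc zero)    j = if j ≡ᵇ 1 then + 2 else + 0
chebU (suc (suc r)) j = shift2 (chebU (suc r)) j - chebU r j

-- (2x)^r · U_r(1/(2x)) as a power series in x (a polynomial, since deg U_r = r):
-- Σ_j c_j (2x)^{r-j}, so the coefficient of x^m is c_{r-m} · 2^m for m ≤ r.
scaledChebU : ℕ → Series
scaledChebU r m = if m ≤ᵇ r then chebU r (r ∸ m) *ℤ (+ (2 ^ m)) else + 0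

A : ℕ → Series
A k n = + (a k n)

module Submission where

open import Defs
open import Data.Bool using (Bool; true; false; _∧_; if_then_else_; T; T?)
open import Data.Bool.Properties using (∧-assoc)
open import Data.Empty using (⊥; ⊥-elim)
open import Data.Integer using (+_) renaming (_+_ to _⊕_; _*_ to _⊗_; _-_ to _⊖_)
import Data.Integer.Properties as ZP
open import Data.Integer.Solver using (module +-*-Solver)
open +-*-Solver using (solve; _:+_; _:*_; _:-_; _:=_; con)
open import Data.List using (List; []; _∷_; [_]; map; concatMap; _++_; length; filterᵇ; applyUpTo; upTo)
open import Data.Nat.ListAction using (sum)
open import Data.List.Properties using (length-map; length-++; ++-assoc; length-applyUpTo)
import Data.List.Properties as LP
open import Data.List.Membership.Propositional using (_∈_; _∉_; lose; find)
open import Data.List.Membership.Propositional.Properties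
  using (∈-map⁺; ∈-map⁻; ∈-++⁺ˡ; ∈-++⁺ʳ; ∈-++⁻; ∈-∃++; ∈-concatMap⁺; ∈-concatMap⁻;
         ∈-applyUpTo⁺; ∈-applyUpTo⁻; ∈-filter⁺; ∈-filter⁻; ∈-upTo⁺; ∈-upTo⁻)
open import Data.List.Membership.Propositional.Properties.WithK using (unique∧set⇒bag)
open import Data.List.Relation.Binary.BagAndSetEquality using (∼bag⇒↭)
open import Data.List.Relation.Binary.Permutation.Propositional.Properties using (↭-length)
open import Data.List.Relation.Unary.Any using (here; there)
open import Data.List.Relation.Unary.All using (All; []; _∷_)
import Data.List.Relation.Unary.All as All
open import Data.List.Relation.Unary.All.Properties using (All¬⇒¬Any)
open import Data.List.Relation.Unary.AllPairs using ([]; _∷_)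
open import Data.List.Relation.Unary.Unique.Propositional using (Unique)
open import Data.List.Relation.Unary.Unique.Propositional.Properties using (filter⁺; ++⁺)
import Data.List.Relation.Unary.Unique.Propositional.Properties as UP
open import Data.Maybe using (Maybe; just; nothing)
open import Data.Nat using (ℕ; zero; suc; _+_; _*_; _∸_; _^_; _≤_; _<_; z≤n; s≤s; _≡ᵇ_; _<ᵇ_; _≤ᵇ_)
open import Data.Nat.Properties
open import Data.List.Membership.DecPropositional _≟_ using (_∈?_)
open import Algebra.Properties.CommutativeSemigroup +-commutativeSemigroup using (interchange)
open import Data.Product using (∃; ∃₂; _×_; _,_; proj₁; proj₂)
open import Data.Sum using (_⊎_; inj₁; inj₂)
open import Data.Unit using (tt)
open import Function.Bundles using (mk⇔)
open import Relation.Binary.Bundles using (Setoid)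
open import Relation.Binary.Definitions using (tri<; tri≈; tri>)
open import Relation.Binary.PropositionalEquality using (_≡_; _≢_; refl; sym; trans; cong; cong₂; subst; module ≡-Reasoning)
import Relation.Binary.Reasoning.Setoid
open import Relation.Nullary using (yes; no)

-- An alternating 132-avoiding permutation of even length 2m + 2 with maximum n has the
-- shape (p + |q| + 1) (|q| + 1) n q, where p and q are again alternating and 132-avoiding
-- and |p| is even; one of odd length 2m + 1 is (p + 1) 1 with |p| = 2m.  For k ≥ 3 an
-- increasing subsequence of length k of the former lies in p, lies in q, or is one of
-- length k - 1 in p completed by n.  Hence the generating functions A_k(y), O_k(y) of the
-- even-length permutations with no, resp. exactly one, occurrence of 12⋯k satisfy
-- A_k = 1 + y A_{k-1} A_k and O_k = y (A_{k-1} O_k + O_{k-1} A_k), with A_2 = 1, O_2 = y.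
-- Putting Q_0 = Q_1 = 1 and Q_{r+2} = Q_{r+1} - y Q_r, induction on r gives
-- A_{r+1} Q_r = Q_{r-1} and O_{r+1} Q_r² = y^r.  As a(2m) = a(2m+1) = [y^m] O_k, the series
-- is (1 + x) O_k(x²), and (2x)^r U_r(1/(2x)) = 2^r Q_r(x²) turns this into the claim.


T⇒≡true : ∀ {b} → T b → b ≡ true
T⇒≡true {true} _ = refl

≡true⇒T : ∀ {b} → b ≡ true → T b
≡true⇒T refl = tt

<ᵇ-true : ∀ {m n} → m < n → (m <ᵇ n) ≡ true
<ᵇ-true p = T⇒≡true (<⇒<ᵇ p)

<ᵇ-false : ∀ {m n} → n ≤ m → (m <ᵇ n) ≡ false
<ᵇ-false {m} {n} le with m <ᵇ n in e
... | false = refl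
... | true = ⊥-elim (<-irrefl refl (<-≤-trans (<ᵇ⇒< m n (≡true⇒T e)) le))

<ᵇ-true⁻ : ∀ {m n} → (m <ᵇ n) ≡ true → m < n
<ᵇ-true⁻ {m} {n} e = <ᵇ⇒< m n (≡true⇒T e)

<ᵇ-false⁻ : ∀ {m n} → (m <ᵇ n) ≡ false → n ≤ m
<ᵇ-false⁻ {m} {n} e with m <? n
... | yes p with () ← trans (sym e) (<ᵇ-true p)
... | no np = ≮⇒≥ np

<ᵇ-asym : ∀ {a b} → (a <ᵇ b) ≡ true → (b <ᵇ a) ≡ false
<ᵇ-asym {a} {b} e = <ᵇ-false (<⇒≤ (<ᵇ-true⁻ {a} {b} e))

<ᵇ-+ʳ : ∀ a b s → (a + s <ᵇ b + s) ≡ (a <ᵇ b)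
<ᵇ-+ʳ a b s with a <ᵇ b in e
... | true = <ᵇ-true {a + s} {b + s} (+-monoˡ-< s (<ᵇ-true⁻ {a} {b} e))
... | false = <ᵇ-false {a + s} {b + s} (+-monoˡ-≤ s (<ᵇ-false⁻ {a} {b} e))

≤ᵇ-true : ∀ {m n} → m ≤ n → (m ≤ᵇ n) ≡ true
≤ᵇ-true le = T⇒≡true (≤⇒≤ᵇ le)

≤ᵇ-false : ∀ {m n} → n < m → (m ≤ᵇ n) ≡ false
≤ᵇ-false {m} {n} lt with m ≤ᵇ n in e
... | false = refl
... | true = ⊥-elim (<-irrefl refl (<-≤-trans lt (≤ᵇ⇒≤ m n (≡true⇒T e))))

∧-true⁻ : ∀ a {b} → a ∧ b ≡ true → a ≡ true × b ≡ true
∧-true⁻ true {true} _ = refl , refl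

∧-true⁺ : ∀ {a b} → a ≡ true → b ≡ true → a ∧ b ≡ true
∧-true⁺ refl refl = refl

if-true : ∀ {A : Set} {b : Bool} {x y : A} → b ≡ true → (if b then x else y) ≡ x
if-true refl = refl

if-false : ∀ {A : Set} {b : Bool} {x y : A} → b ≡ false → (if b then x else y) ≡ y
if-false refl = refl

allᵇ⁻ : ∀ {p : ℕ → Bool} {xs x} → allᵇ p xs ≡ true → x ∈ xs → p x ≡ true
allᵇ⁻ {p} {y ∷ ys} e (here refl) with p y
... | true = refl
allᵇ⁻ {p} {y ∷ ys} e (there m) with p y
... | true = allᵇ⁻ e m

allᵇ⁺ : ∀ {p : ℕ → Bool} {xs} → (∀ {x} → x ∈ xs → p x ≡ true) → allᵇ p xs ≡ true
allᵇ⁺ {p} {[]} f = refl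
allᵇ⁺ {p} {y ∷ ys} f rewrite f (here refl) = allᵇ⁺ (λ m → f (there m))

allᵇ-<ᵇ-weaken : ∀ {b x} u → b < x → allᵇ (x <ᵇ_) u ≡ true → allᵇ (b <ᵇ_) u ≡ true
allᵇ-<ᵇ-weaken [] _ _ = refl
allᵇ-<ᵇ-weaken {b} {x} (y ∷ u) bx h =
  ∧-true⁺ (<ᵇ-true {b} {y} (<-trans bx (<ᵇ-true⁻ {x} {y} (proj₁ (∧-true⁻ (x <ᵇ y) h)))))
      (allᵇ-<ᵇ-weaken u bx (proj₂ (∧-true⁻ (x <ᵇ y) h)))

m+n≡1⇒ : ∀ a b → a + b ≡ 1 → (a ≡ 0 × b ≡ 1) ⊎ (a ≡ 1 × b ≡ 0)
m+n≡1⇒ zero b e = inj₁ (refl , e)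
m+n≡1⇒ (suc zero) zero e = inj₂ (refl , refl)
m+n≡1⇒ (suc zero) (suc b) ()
m+n≡1⇒ (suc (suc a)) b ()

<⇒≤∸1 : ∀ {y c} → y < c → y ≤ c ∸ 1
<⇒≤∸1 {y} {suc c} (s≤s le) = le

∸-suc : ∀ {m r} → m < r → r ∸ m ≡ suc (r ∸ suc m)
∸-suc {zero} {suc r} _ = refl
∸-suc {suc m} {suc r} (s≤s lt) = ∸-suc lt

4^≡2^*2^ : ∀ r → 4 ^ r ≡ 2 ^ r * 2 ^ r
4^≡2^*2^ r = trans (^-*-assoc 2 2 r) (trans (^-distribˡ-+-* 2 r (r + 0)) (cong (λ e → 2 ^ r * 2 ^ e) (+-identityʳ r)))


sameMembers⇒length≡ : ∀ {A : Set} {xs ys : List A} → Unique xs → Unique ys → (∀ {z} → z ∈ xs → z ∈ ys)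
  → (∀ {z} → z ∈ ys → z ∈ xs) → length xs ≡ length ys
sameMembers⇒length≡ ux uy f g = ↭-length (∼bag⇒↭ (unique∧set⇒bag ux uy (λ {z} → mk⇔ f g)))

∈-filterᵇ⁻ : ∀ {A : Set} {p : A → Bool} {xs} {x} → x ∈ filterᵇ p xs → x ∈ xs × p x ≡ true
∈-filterᵇ⁻ {p = p} {xs} m with ∈-filter⁻ (λ x → T? (p x)) {xs = xs} m
... | a , b = a , T⇒≡true b

∈-filterᵇ⁺ : ∀ {A : Set} {p : A → Bool} {xs} {x} → x ∈ xs → p x ≡ true → x ∈ filterᵇ p xs
∈-filterᵇ⁺ {p = p} m e = ∈-filter⁺ (λ x → T? (p x)) m (≡true⇒T e)

unique-filterᵇ : ∀ {A : Set} {p : A → Bool} {xs} → Unique xs → Unique (filterᵇ p xs)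
unique-filterᵇ {p = p} u = filter⁺ (λ x → T? (p x)) u

unique-map⁺ : ∀ {A B : Set} {f : A → B} {xs} → Unique xs → (∀ {x y} → x ∈ xs → y ∈ xs → f x ≡ f y → x ≡ y)
  → Unique (map f xs)
unique-map⁺ {xs = []} [] inj = []
unique-map⁺ {f = f} {xs = x ∷ xs} (px ∷ u) inj = fx-fresh px (λ m → m) ∷ unique-map⁺ u
    (λ a b e → inj (there a) (there b) e)
  where
  fx-fresh : ∀ {ys} → All (x ≢_) ys → (∀ {y} → y ∈ ys → y ∈ xs) → All (f x ≢_) (map f ys)
  fx-fresh [] _ = []
  fx-fresh (q ∷ qs) ys⊆xs = (λ e → q (inj (here refl) (there (ys⊆xs (here refl))) e)) ∷ fx-fresh qs
      (λ m → ys⊆xs (there m))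

unique-concatMap : ∀ {A B : Set} (f : A → List B) {xs} → Unique xs → (∀ {x} → x ∈ xs → Unique (f x)) →
  (∀ {x y z} → x ∈ xs → y ∈ xs → z ∈ f x → z ∈ f y → x ≡ y) → Unique (concatMap f xs)
unique-concatMap f {[]} [] ui dj = []
unique-concatMap f {x ∷ xs} (px ∷ u) ui dj =
  ++⁺ (ui (here refl)) (unique-concatMap f u (λ m → ui (there m)) (λ a b c d → dj (there a) (there b) c d))
      (λ { (z1 , z2) → disjoint z1 (find (∈-concatMap⁻ f {xs = xs} z2)) })
  where
  disjoint : ∀ {z} → z ∈ f x → (∃ λ y → y ∈ xs × z ∈ f y) → ⊥
  disjoint z1 (y , ym , z2) = All.lookup px ym (dj (here refl) (there ym) z1 z2)

module _ {A : Set} where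
  ⊆-remove : ∀ {xs : List A} {ys1 ys2 v} → v ∉ xs → (∀ {z} → z ∈ xs → z ∈ ys1 ++ v ∷ ys2) → ∀ {z} → z ∈ xs
    → z ∈ ys1 ++ ys2
  ⊆-remove {ys1 = ys1} {ys2} {v} nv xs⊆ {z} zm with ∈-++⁻ ys1 (xs⊆ zm)
  ... | inj₁ a = ∈-++⁺ˡ a
  ... | inj₂ (here refl) = ⊥-elim (nv zm)
  ... | inj₂ (there b) = ∈-++⁺ʳ ys1 b

  unique-⊆⇒length≤ : ∀ {xs ys : List A} → Unique xs → (∀ {z} → z ∈ xs → z ∈ ys) → length xs ≤ length ys
  unique-⊆⇒length≤ {[]} _ _ = z≤n
  unique-⊆⇒length≤ {x ∷ xs} {ys} (px ∷ u) xs⊆ys with ∈-∃++ (xs⊆ys (here refl))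
  ... | ys1 , ys2 , refl =
    subst (λ t → suc (length xs) ≤ t) (sym (LP.length-++-sucʳ ys1 x ys2))
      (s≤s (unique-⊆⇒length≤ u (⊆-remove (All¬⇒¬Any px) (λ m → xs⊆ys (there m)))))

  unique-⊊⇒length< : ∀ {xs ys : List A} {v} → Unique xs → (∀ {z} → z ∈ xs → z ∈ ys) → v ∈ ys → v ∉ xs
    → length xs < length ys
  unique-⊊⇒length< {xs} {ys} {v} u xs⊆ys vm nv with ∈-∃++ vm
  ... | ys1 , ys2 , refl =
    subst (λ t → suc (length xs) ≤ t) (sym (LP.length-++-sucʳ ys1 v ys2))
      (s≤s (unique-⊆⇒length≤ u (⊆-remove nv xs⊆ys)))

Unique-++⁻ : ∀ {A : Set} (xs : List A) {ys} → Unique (xs ++ ys) → Unique xs × Unique ys × (∀ {z} → z ∈ xs → z ∈ ys → ⊥)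
Unique-++⁻ [] u = [] , u , (λ ())
Unique-++⁻ (x ∷ xs) {ys} (px ∷ u) with Unique-++⁻ xs u
... | ux , uy , dj = All.tabulate (λ m → All.lookup px (∈-++⁺ˡ m)) ∷ ux , uy , disjoint
  where
  disjoint : ∀ {z} → z ∈ x ∷ xs → z ∈ ys → ⊥
  disjoint (here refl) m = All.lookup px (∈-++⁺ʳ xs m) refl
  disjoint (there a) m = dj a m

Unique-++⁺ : ∀ {A : Set} {xs ys : List A} → Unique xs → Unique ys → (∀ {z} → z ∈ xs → z ∈ ys → ⊥) → Unique (xs ++ ys)
Unique-++⁺ ux uy dj = ++⁺ ux uy (λ { (a , b) → dj a b })

++-∷-unique-split : ∀ (xs xs' : List ℕ) {ys ys' N} → N ∉ xs → N ∉ xs' → xs ++ N ∷ ys ≡ xs' ++ N ∷ ys' → xs ≡ xs' × ys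
  ≡ ys'
++-∷-unique-split [] [] nx nx' e = refl , LP.∷-injectiveʳ e
++-∷-unique-split [] (x' ∷ xs') nx nx' e = ⊥-elim (nx' (here (LP.∷-injectiveˡ e)))
++-∷-unique-split (x ∷ xs) [] nx nx' e = ⊥-elim (nx (here (sym (LP.∷-injectiveˡ e))))
++-∷-unique-split (x ∷ xs) (x' ∷ xs') nx nx' e with LP.∷-injectiveˡ e
... | refl with ++-∷-unique-split xs xs' (λ m → nx (there m)) (λ m → nx' (there m)) (LP.∷-injectiveʳ e)
... | e1 , e2 = cong (x ∷_) e1 , e2

map-+-∸ : ∀ s xs → (∀ {a} → a ∈ xs → s ≤ a) → map (_+ s) (map (_∸ s) xs) ≡ xs
map-+-∸ s [] _ = refl
map-+-∸ s (x ∷ xs) h = cong₂ _∷_ (m∸n+n≡m (h (here refl))) (map-+-∸ s xs (λ m → h (there m)))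

unique-shift : ∀ s {xs} → Unique xs → Unique (map (_+ s) xs)
unique-shift s u = unique-map⁺ u (λ _ _ e → +-cancelʳ-≡ _ _ _ e)

countᵇ : (List ℕ → Bool) → List (List ℕ) → ℕ
countᵇ P xs = length (filterᵇ P xs)

countᵇ-++ : ∀ P xs ys → countᵇ P (xs ++ ys) ≡ countᵇ P xs + countᵇ P ys
countᵇ-++ P [] ys = refl
countᵇ-++ P (x ∷ xs) ys with P x
... | true = cong suc (countᵇ-++ P xs ys)
... | false = countᵇ-++ P xs ys

countᵇ-map : ∀ P (f : List ℕ → List ℕ) xs → countᵇ P (map f xs) ≡ countᵇ (λ u → P (f u)) xs
countᵇ-map P f [] = refl
countᵇ-map P f (x ∷ xs) with P (f x)
... | true = cong suc (countᵇ-map P f xs)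
... | false = countᵇ-map P f xs

countᵇ-cong : ∀ {P Q} xs → (∀ {u} → u ∈ xs → P u ≡ Q u) → countᵇ P xs ≡ countᵇ Q xs
countᵇ-cong [] f = refl
countᵇ-cong {P} {Q} (x ∷ xs) f with P x | Q x | f (here refl)
... | true | true | _ = cong suc (countᵇ-cong xs (λ m → f (there m)))
... | false | false | _ = countᵇ-cong xs (λ m → f (there m))

countᵇ-none : ∀ {P} xs → (∀ {u} → u ∈ xs → P u ≡ false) → countᵇ P xs ≡ 0
countᵇ-none [] f = refl
countᵇ-none {P} (x ∷ xs) f with P x | f (here refl)
... | false | _ = countᵇ-none xs (λ m → f (there m))

countᵇ-pos : ∀ {P} xs {u} → u ∈ xs → P u ≡ true → 0 < countᵇ P xs
countᵇ-pos {P} (x ∷ xs) (here refl) e with P x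
countᵇ-pos {P} (x ∷ xs) (here refl) refl | true = s≤s z≤n
countᵇ-pos {P} (x ∷ xs) (there m) e with P x
... | true = s≤s z≤n
... | false = countᵇ-pos xs m e

countᵇ-concatMap : ∀ {A : Set} P (f : A → List (List ℕ)) xs → countᵇ P (concatMap f xs)
  ≡ sum (map (λ x → countᵇ P (f x)) xs)
countᵇ-concatMap P f [] = refl
countᵇ-concatMap P f (x ∷ xs) = trans (countᵇ-++ P (f x) (concatMap f xs))
    (cong (λ n → countᵇ P (f x) + n) (countᵇ-concatMap P f xs))

countᵇ-sameMembers : ∀ P {xs ys} → Unique xs → Unique ys → (∀ {z} → z ∈ xs → z ∈ ys) → (∀ {z} → z ∈ ys → z ∈ xs)
  → countᵇ P xs ≡ countᵇ P ys
countᵇ-sameMembers P {xs} {ys} ux uy f g = sameMembers⇒length≡ (unique-filterᵇ ux) (unique-filterᵇ uy)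
  (λ m → ∈-filterᵇ⁺ (f (proj₁ (∈-filterᵇ⁻ {p = P} {xs = xs} m))) (proj₂ (∈-filterᵇ⁻ {p = P} {xs = xs} m)))
  (λ m → ∈-filterᵇ⁺ (g (proj₁ (∈-filterᵇ⁻ {p = P} {xs = ys} m))) (proj₂ (∈-filterᵇ⁻ {p = P} {xs = ys} m)))

countᵇ-filterᵇ : ∀ (P Q : List ℕ → Bool) xs → countᵇ (λ x → P x ∧ Q x) xs ≡ countᵇ Q (filterᵇ P xs)
countᵇ-filterᵇ P Q [] = refl
countᵇ-filterᵇ P Q (x ∷ xs) with P x
... | true with Q x
... | true = cong suc (countᵇ-filterᵇ P Q xs)
... | false = countᵇ-filterᵇ P Q xs
countᵇ-filterᵇ P Q (x ∷ xs) | false = countᵇ-filterᵇ P Q xs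

sum-map-cong∈ : ∀ {A : Set} (f g : A → ℕ) xs → (∀ {x} → x ∈ xs → f x ≡ g x) → sum (map f xs) ≡ sum (map g xs)
sum-map-cong∈ f g [] h = refl
sum-map-cong∈ f g (x ∷ xs) h = cong₂ _+_ (h (here refl)) (sum-map-cong∈ f g xs (λ m → h (there m)))

sum-map-+ : ∀ {A : Set} (f g : A → ℕ) xs → sum (map (λ x → f x + g x) xs) ≡ sum (map f xs) + sum (map g xs)
sum-map-+ f g [] = refl
sum-map-+ f g (x ∷ xs) rewrite sum-map-+ f g xs = interchange (f x) (g x) (sum (map f xs)) (sum (map g xs))

sum-map-if : ∀ (P : List ℕ → Bool) X xs → sum (map (λ p → if P p then X else 0) xs) ≡ countᵇ P xs * X
sum-map-if P X [] = refl
sum-map-if P X (x ∷ xs) with P x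
... | true = cong (λ n → X + n) (sum-map-if P X xs)
... | false = sum-map-if P X xs

sum-map-zero : ∀ {A : Set} (f : A → ℕ) xs → (∀ {x} → x ∈ xs → f x ≡ 0) → sum (map f xs) ≡ 0
sum-map-zero f [] h = refl
sum-map-zero f (x ∷ xs) h rewrite h (here refl) = sum-map-zero f xs (λ m → h (there m))


data Even : List ℕ → Set where

  even[] : Even []
  even∷ : ∀ {a b xs} → Even xs → Even (a ∷ b ∷ xs)

length-double⇒Even : ∀ i xs → length xs ≡ i + i → Even xs
length-double⇒Even zero [] _ = even[]
length-double⇒Even (suc i) (a ∷ []) e with () ← trans (suc-injective e) (+-suc i i)
length-double⇒Even (suc i) (a ∷ b ∷ xs) e = even∷
    (length-double⇒Even i xs (suc-injective (trans (suc-injective e) (+-suc i i))))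

Even⇒length-double : ∀ {xs} → Even xs → ∃ λ i → length xs ≡ i + i
Even⇒length-double even[] = 0 , refl
Even⇒length-double (even∷ {xs = xs} e) with Even⇒length-double e
... | i , l = suc i , cong suc (trans (cong suc l) (sym (+-suc i i)))

double-difference : ∀ i x m → (i + i) + x ≡ m + m → ∃ λ j → x ≡ j + j × i + j ≡ m
double-difference zero x m e = m , e , refl
double-difference (suc i) x zero ()
double-difference (suc i) x (suc m) e with double-difference i x m
    (suc-injective (suc-injective (trans (sym (cong (λ t → suc t + x) (+-suc i i))) (trans e (cong suc (+-suc m m))))))
... | j , ex , eij = j , ex , cong suc eij

double-injective : ∀ a b → a + a ≡ b + b → a ≡ b
double-injective a b e with double-difference a 0 b (trans (+-identityʳ _) e)
... | zero , _ , eij = trans (sym (+-identityʳ a)) eij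
... | suc j , () , _

suc-suc-double : ∀ m → suc (suc (m + m)) ≡ suc m + suc m
suc-suc-double m = cong suc (sym (+-suc m m))

even-or-odd : ∀ n → ∃ λ m → n ≡ m + m ⊎ n ≡ suc (m + m)
even-or-odd zero = 0 , inj₁ refl
even-or-odd (suc n) with even-or-odd n
... | m , inj₁ e = m , inj₂ (cong suc e)
... | m , inj₂ e = suc m , inj₁ (trans (cong suc e) (cong suc (sym (+-suc m m))))

Even-map : ∀ (f : ℕ → ℕ) {xs} → Even xs → Even (map f xs)
Even-map f even[] = even[]
Even-map f (even∷ e) = even∷ (Even-map f e)


-- Permutations

InRange : ℕ → ℕ → Set
InRange n x = 0 < x × x ≤ n

∈-range⁺ : ∀ {n a} → InRange n a → a ∈ applyUpTo suc n
∈-range⁺ {n} {suc a} (_ , le) = ∈-applyUpTo⁺ suc {i = a} le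

∈-range⁻ : ∀ {n a} → a ∈ applyUpTo suc n → InRange n a
∈-range⁻ {n} m with ∈-applyUpTo⁻ suc m
... | i , lt , refl = s≤s z≤n , lt

∈-words⁺ : ∀ n π → All (InRange n) π → π ∈ words n (length π)
∈-words⁺ n [] [] = here refl
∈-words⁺ n (a ∷ w) (ra ∷ rw) =
  ∈-concatMap⁺ (λ w → map (λ a → a ∷ w) (applyUpTo suc n)) (lose (∈-words⁺ n w rw) (∈-map⁺ (λ a → a ∷ w) (∈-range⁺ ra)))

∈-words⁻ : ∀ n l π → π ∈ words n l → length π ≡ l × All (InRange n) π
∈-words⁻ n zero π (here refl) = refl , []
∈-words⁻ n (suc l) π m with find (∈-concatMap⁻ (λ w → map (λ a → a ∷ w) (applyUpTo suc n)) {xs = words n l} m)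
... | w , wm , pm with ∈-map⁻ (λ a → a ∷ w) pm
... | a , am , refl with ∈-words⁻ n l w wm
... | e , aw = cong suc e , ∈-range⁻ am ∷ aw

unique-range : ∀ n → Unique (applyUpTo suc n)
unique-range n = UP.applyUpTo⁺₁ suc n (λ i<j _ e → <⇒≢ i<j (suc-injective e))

unique-words : ∀ n l → Unique (words n l)
unique-words n zero = [] ∷ []
unique-words n (suc l) = unique-concatMap (λ w → map (λ a → a ∷ w) (applyUpTo suc n)) (unique-words n l)
  (λ _ → unique-map⁺ (unique-range n) (λ _ _ e → LP.∷-injectiveˡ e))
  (λ _ _ z1 z2 → same-tail z1 z2)
  where
  same-tail : ∀ {x y z} → z ∈ map (λ a → a ∷ x) (applyUpTo suc n) → z ∈ map (λ a → a ∷ y) (applyUpTo suc n) → x ≡ y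
  same-tail z1 z2 with ∈-map⁻ _ z1 | ∈-map⁻ _ z2
  ... | _ , _ , refl | _ , _ , refl = refl

countLetter-∉ : ∀ {i w} → i ∉ w → countLetter i w ≡ 0
countLetter-∉ {i} {[]} _ = refl
countLetter-∉ {i} {a ∷ w} nm with i ≡ᵇ a in eq
... | true = ⊥-elim (nm (here (≡ᵇ⇒≡ i a (≡true⇒T eq))))
... | false = countLetter-∉ (λ m → nm (there m))

countLetter-∈ : ∀ {i w} → i ∈ w → 1 ≤ countLetter i w
countLetter-∈ {i} {a ∷ w} m with i ≡ᵇ a in eq
... | true = s≤s z≤n
countLetter-∈ {i} {a ∷ w} (here refl) | false with () ← trans (sym eq) (T⇒≡true (≡⇒≡ᵇ i i refl))
countLetter-∈ {i} {a ∷ w} (there m) | false = countLetter-∈ m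

countLetter-unique : ∀ {i w} → Unique w → countLetter i w ≤ 1
countLetter-unique {i} {[]} _ = z≤n
countLetter-unique {i} {a ∷ w} (pa ∷ u) with i ≡ᵇ a in eq
... | true with ≡ᵇ⇒≡ i a (≡true⇒T eq)
... | refl rewrite countLetter-∉ {i} {w} (All¬⇒¬Any pa) = s≤s z≤n
countLetter-unique {i} {a ∷ w} (pa ∷ u) | false = countLetter-unique {i} u

countLetter-∷ : ∀ {i a w} → countLetter i w ≤ countLetter i (a ∷ w)
countLetter-∷ {i} {a} {w} with i ≡ᵇ a
... | true = n≤1+n _
... | false = ≤-refl

countLetter≤1⇒unique : ∀ {w} → (∀ {x} → x ∈ w → countLetter x w ≤ 1) → Unique w
countLetter≤1⇒unique {[]} f = []
countLetter≤1⇒unique {a ∷ w} f = All.tabulate (λ {y} ym e → not-repeated e ym) ∷ countLetter≤1⇒unique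
    (λ {x} m → ≤-trans (countLetter-∷ {x} {a} {w}) (f (there m)))
  where
  not-repeated : ∀ {y} → a ≡ y → y ∈ w → ⊥
  not-repeated refl ym with a ≡ᵇ a in eq
  ... | false with () ← trans (sym eq) (T⇒≡true (≡⇒≡ᵇ a a refl))
  ... | true = <-irrefl refl (≤-trans (s≤s (countLetter-∈ ym))
      (subst (λ t → t ≤ 1) (countLetter-head eq) (f (here refl))))
    where
    countLetter-head : (a ≡ᵇ a) ≡ true → countLetter a (a ∷ w) ≡ suc (countLetter a w)
    countLetter-head e rewrite e = refl

IsPerm : ℕ → List ℕ → Set
IsPerm n π = Unique π × length π ≡ n × All (InRange n) π

IsPerm-∈ : ∀ {n π v} → IsPerm n π → InRange n v → v ∈ π
IsPerm-∈ {n} {π} {v} (u , l , r) iv with v ∈? π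
... | yes m = m
... | no nm = ⊥-elim (<-irrefl length≡ (unique-⊊⇒length< u (λ m → ∈-range⁺ (All.lookup r m)) (∈-range⁺ iv) nm))
  where
  length≡ : length π ≡ length (applyUpTo suc n)
  length≡ = trans l (sym (length-applyUpTo suc n))

∈-perms⁻ : ∀ {n π} → π ∈ perms n → IsPerm n π
∈-perms⁻ {n} {π} m with ∈-filterᵇ⁻ {xs = words n n} m
... | wm , ip with ∈-words⁻ n n π wm
... | l , r = countLetter≤1⇒unique (λ xm → ≤-reflexive (≡ᵇ⇒≡ _ 1 (≡true⇒T (allᵇ⁻ ip (∈-range⁺ (All.lookup r xm)))))) , l
    , r

∈-perms⁺ : ∀ {n π} → IsPerm n π → π ∈ perms n
∈-perms⁺ {n} {π} (u , l , r) = ∈-filterᵇ⁺ (subst (λ t → π ∈ words n t) l (∈-words⁺ n π r))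
  (allᵇ⁺ {p = λ i → countLetter i π ≡ᵇ 1}
      (λ {x} xm → T⇒≡true (≡⇒≡ᵇ _ 1 (≤-antisym (countLetter-unique {x} u)
      (countLetter-∈ (IsPerm-∈ (u , l , r) (∈-range⁻ xm)))))))

unique-perms : ∀ n → Unique (perms n)
unique-perms n = unique-filterᵇ (unique-words n n)


-- Subsequences and the pattern 132

infix 4 _⊑_

data _⊑_ : List ℕ → List ℕ → Set where

  done : ∀ {ys} → [] ⊑ ys
  skip : ∀ {us y ys} → us ⊑ ys → us ⊑ (y ∷ ys)
  keep : ∀ {us y ys} → us ⊑ ys → (y ∷ us) ⊑ (y ∷ ys)

⊑⇒∈-subseqs : ∀ {u π} → u ⊑ π → u ∈ subseqs (length u) π
⊑⇒∈-subseqs {[]} {π} _ with π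
... | [] = here refl
... | _ ∷ _ = here refl
⊑⇒∈-subseqs {y ∷ us} {x ∷ xs} (skip s) = ∈-++⁺ʳ (map (x ∷_) (subseqs (length us) xs)) (⊑⇒∈-subseqs s)
⊑⇒∈-subseqs {y ∷ us} {x ∷ xs} (keep s) = ∈-++⁺ˡ (∈-map⁺ (x ∷_) (⊑⇒∈-subseqs s))

∈-subseqs⇒⊑ : ∀ m π {u} → u ∈ subseqs m π → u ⊑ π × length u ≡ m
∈-subseqs⇒⊑ zero π (here refl) = done , refl
∈-subseqs⇒⊑ (suc m) (x ∷ xs) mem with ∈-++⁻ (map (x ∷_) (subseqs m xs)) mem
... | inj₂ b with ∈-subseqs⇒⊑ (suc m) xs b
... | s , l = skip s , l
∈-subseqs⇒⊑ (suc m) (x ∷ xs) mem | inj₁ a with ∈-map⁻ (x ∷_) a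
... | v , vm , refl with ∈-subseqs⇒⊑ m xs vm
... | s , l = keep s , cong suc l

⊑-mem : ∀ {u π x} → u ⊑ π → x ∈ u → x ∈ π
⊑-mem (skip s) m = there (⊑-mem s m)
⊑-mem (keep s) (here refl) = here refl
⊑-mem (keep s) (there m) = there (⊑-mem s m)

⊑-split : ∀ xs {ys u} → u ⊑ xs ++ ys → ∃₂ λ u1 u2 → u ≡ u1 ++ u2 × u1 ⊑ xs × u2 ⊑ ys
⊑-split [] s = [] , _ , refl , done , s
⊑-split (x ∷ xs) done = [] , [] , refl , done , done
⊑-split (x ∷ xs) (skip s) with ⊑-split xs s
... | u1 , u2 , refl , s1 , s2 = u1 , u2 , refl , skip s1 , s2
⊑-split (x ∷ xs) (keep s) with ⊑-split xs s
... | u1 , u2 , refl , s1 , s2 = x ∷ u1 , u2 , refl , keep s1 , s2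

⊑-++ˡ : ∀ {u xs} ys → u ⊑ xs → u ⊑ xs ++ ys
⊑-++ˡ ys done = done
⊑-++ˡ ys (skip s) = skip (⊑-++ˡ ys s)
⊑-++ˡ ys (keep s) = keep (⊑-++ˡ ys s)

⊑-++ʳ : ∀ {u ys} xs → u ⊑ ys → u ⊑ xs ++ ys
⊑-++ʳ [] s = s
⊑-++ʳ (x ∷ xs) s = skip (⊑-++ʳ xs s)

⊑-refl : ∀ xs → xs ⊑ xs
⊑-refl [] = done
⊑-refl (x ∷ xs) = keep (⊑-refl xs)

⊑-trans : ∀ {u v w} → u ⊑ v → v ⊑ w → u ⊑ w
⊑-trans done _ = done
⊑-trans s (skip t) = skip (⊑-trans s t)
⊑-trans (skip s) (keep t) = skip (⊑-trans s t)
⊑-trans (keep s) (keep t) = keep (⊑-trans s t)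

⊑-map⁺ : ∀ (f : ℕ → ℕ) {u xs} → u ⊑ xs → map f u ⊑ map f xs
⊑-map⁺ f done = done
⊑-map⁺ f (skip s) = skip (⊑-map⁺ f s)
⊑-map⁺ f (keep s) = keep (⊑-map⁺ f s)

⊑-map⁻ : ∀ (f : ℕ → ℕ) {u} xs → u ⊑ map f xs → ∃ λ v → u ≡ map f v × v ⊑ xs
⊑-map⁻ f [] done = [] , refl , done
⊑-map⁻ f (x ∷ xs) done = [] , refl , done
⊑-map⁻ f (x ∷ xs) (skip s) with ⊑-map⁻ f xs s
... | v , refl , t = v , refl , skip t
⊑-map⁻ f (x ∷ xs) (keep s) with ⊑-map⁻ f xs s
... | v , refl , t = x ∷ v , refl , keep t

⊑-length : ∀ {u v} → u ⊑ v → length u ≤ length v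
⊑-length done = z≤n
⊑-length (skip s) = m≤n⇒m≤1+n (⊑-length s)
⊑-length (keep s) = s≤s (⊑-length s)

∈⇒[x]⊑ : ∀ {y β} → y ∈ β → (y ∷ []) ⊑ β
∈⇒[x]⊑ (here refl) = keep done
∈⇒[x]⊑ (there m) = skip (∈⇒[x]⊑ m)

∈-∷-⊑-++ : ∀ {a xs u} ys → a ∈ xs → u ⊑ ys → (a ∷ u) ⊑ xs ++ ys
∈-∷-⊑-++ {xs = x ∷ xs} ys (here refl) s = keep (⊑-++ʳ xs s)
∈-∷-⊑-++ {xs = x ∷ xs} ys (there m) s = skip (∈-∷-⊑-++ ys m s)

countSubseqs : (List ℕ → Bool) → ℕ → List ℕ → ℕ
countSubseqs P m xs = countᵇ P (subseqs m xs)

countSubseqs-∷ : ∀ P m x xs → countSubseqs P (suc m) (x ∷ xs)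
  ≡ countSubseqs (λ u → P (x ∷ u)) m xs + countSubseqs P (suc m) xs
countSubseqs-∷ P m x xs = trans (countᵇ-++ P (map (x ∷_) (subseqs m xs)) (subseqs (suc m) xs))
  (cong (_+ countSubseqs P (suc m) xs) (countᵇ-map P (x ∷_) (subseqs m xs)))

Avoids132 : List ℕ → Set
Avoids132 π = ∀ {p q r} → (p ∷ q ∷ r ∷ []) ⊑ π → p < r → r < q → ⊥

orderIso132⁺ : ∀ {p q r} → p < r → r < q → orderIsoᵇ pat132 (p ∷ q ∷ r ∷ []) ≡ true
orderIso132⁺ {p} {q} {r} pr rq
  rewrite <ᵇ-true (<-trans pr rq) | <ᵇ-false {q} {p} (<⇒≤ (<-trans pr rq)) | <ᵇ-true pr | <ᵇ-false {r} {p} (<⇒≤ pr)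
        | <ᵇ-false {q} {r} (<⇒≤ rq) | <ᵇ-true rq = refl

orderIso132⁻ : ∀ {p q r} → orderIsoᵇ pat132 (p ∷ q ∷ r ∷ []) ≡ true → p < r × r < q
orderIso132⁻ {p} {q} {r} e with ∧-true⁻ (agreeWith 1 p (3 ∷ 2 ∷ []) (q ∷ r ∷ [])) e
... | e1 , e2 with ∧-true⁻ (p <ᵇ q) e1
... | _ , e3 with ∧-true⁻ (false == (q <ᵇ p)) e3
... | _ , e4 with ∧-true⁻ (p <ᵇ r) e4
... | e5 , _ with ∧-true⁻ (agreeWith 3 q (2 ∷ []) (r ∷ [])) e2
... | e6 , _ with ∧-true⁻ (false == (q <ᵇ r)) e6
... | _ , e7 with ∧-true⁻ (r <ᵇ q) e7
... | e8 , _ = <ᵇ-true⁻ e5 , <ᵇ-true⁻ e8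

occurrences132≡0⇒avoids : ∀ π → occurrences pat132 π ≡ 0 → Avoids132 π
occurrences132≡0⇒avoids π e s pr rq = <-irrefl (sym e) (countᵇ-pos (subseqs 3 π) (⊑⇒∈-subseqs s) (orderIso132⁺ pr rq))

avoids⇒occurrences132≡0 : ∀ π → Avoids132 π → occurrences pat132 π ≡ 0
avoids⇒occurrences132≡0 π av = countᵇ-none (subseqs 3 π) f
  where
  f : ∀ {u} → u ∈ subseqs 3 π → orderIsoᵇ pat132 u ≡ false
  f {u} m with ∈-subseqs⇒⊑ 3 π m
  f {p ∷ q ∷ r ∷ []} m | s , _ with orderIsoᵇ pat132 (p ∷ q ∷ r ∷ []) in e
  ... | false = refl
  ... | true with orderIso132⁻ e
  ... | pr , rq = ⊥-elim (av s pr rq)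

Avoids132-⊑ : ∀ {u π} → u ⊑ π → Avoids132 π → Avoids132 u
Avoids132-⊑ s av t pr rq = av (⊑-trans t s) pr rq

Avoids132-[x] : ∀ c → Avoids132 (c ∷ [])
Avoids132-[x] c s _ _ with ⊑-length s
... | s≤s ()

Avoids132-++-above : ∀ xs ys → Avoids132 xs → Avoids132 ys → (∀ {x y} → x ∈ xs → y ∈ ys → y < x) → Avoids132 (xs ++ ys)
Avoids132-++-above xs ys ax ay cr {p} {q} {r} s pr rq with ⊑-split xs s
... | [] , u2 , refl , s1 , s2 = ay s2 pr rq
... | (_ ∷ []) , u2 , refl , s1 , s2 = <-asym pr (cr (⊑-mem s1 (here refl)) (⊑-mem s2 (there (here refl))))
... | (_ ∷ _ ∷ []) , u2 , refl , s1 , s2 = <-asym pr (cr (⊑-mem s1 (here refl)) (⊑-mem s2 (here refl)))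
... | (_ ∷ _ ∷ _ ∷ []) , [] , refl , s1 , s2 = ax s1 pr rq
... | (_ ∷ _ ∷ _ ∷ []) , (_ ∷ _) , () , s1 , s2
... | (_ ∷ _ ∷ _ ∷ _ ∷ _) , u2 , () , s1 , s2

Avoids132-∷ʳ-max : ∀ xs N → Avoids132 xs → (∀ {x} → x ∈ xs → x < N) → Avoids132 (xs ++ [ N ])
Avoids132-∷ʳ-max xs N ax lt {p} {q} {r} s pr rq with ⊑-split xs s
... | [] , u2 , refl , s1 , s2 with ⊑-length s2
... | s≤s ()
Avoids132-∷ʳ-max xs N ax lt {p} {q} {r} s pr rq | (_ ∷ []) , u2 , refl , s1 , s2 with ⊑-length s2
... | s≤s ()
Avoids132-∷ʳ-max xs N ax lt {p} {q} {r} s pr rq | (_ ∷ _ ∷ []) , u2 , refl , s1 , s2 with ⊑-mem s2 (here refl)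
... | here refl = <-asym rq (lt (⊑-mem s1 (there (here refl))))
Avoids132-∷ʳ-max xs N ax lt {p} {q} {r} s pr rq | (_ ∷ _ ∷ _ ∷ []) , [] , refl , s1 , s2 = ax s1 pr rq
Avoids132-∷ʳ-max xs N ax lt {p} {q} {r} s pr rq | (_ ∷ _ ∷ _ ∷ []) , (_ ∷ _) , () , s1 , s2
Avoids132-∷ʳ-max xs N ax lt {p} {q} {r} s pr rq | (_ ∷ _ ∷ _ ∷ _ ∷ _) , u2 , () , s1 , s2

Avoids132-shift⁺ : ∀ s xs → Avoids132 xs → Avoids132 (map (_+ s) xs)
Avoids132-shift⁺ s xs av t pr rq with ⊑-map⁻ (_+ s) xs t
... | (a ∷ b ∷ c ∷ []) , refl , t' = av t' (+-cancelʳ-< _ _ _ pr) (+-cancelʳ-< _ _ _ rq)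

Avoids132-shift⁻ : ∀ s xs → Avoids132 (map (_+ s) xs) → Avoids132 xs
Avoids132-shift⁻ s xs av t pr rq = av (⊑-map⁺ (_+ s) t) (+-monoˡ-< s pr) (+-monoˡ-< s rq)


-- Increasing subsequences

increasingᵇ : List ℕ → Bool
increasingᵇ [] = true
increasingᵇ (x ∷ xs) = allᵇ (x <ᵇ_) xs ∧ increasingᵇ xs

agreeWith-increasing : ∀ a b τ u → allᵇ (a <ᵇ_) τ ≡ true → length u ≡ length τ → agreeWith a b τ u ≡ allᵇ (b <ᵇ_) u
agreeWith-increasing a b [] [] _ _ = refl
agreeWith-increasing a b (a' ∷ τ) (b' ∷ u) h l with ∧-true⁻ (a <ᵇ a') h
... | h1 , h2 rewrite h1 | <ᵇ-asym {a} {a'} h1 with b <ᵇ b' in e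
... | true rewrite <ᵇ-asym {b} {b'} e = agreeWith-increasing a b τ u h2 (suc-injective l)
... | false = refl

orderIso-increasing : ∀ τ u → increasingᵇ τ ≡ true → length u ≡ length τ → orderIsoᵇ τ u ≡ increasingᵇ u
orderIso-increasing [] [] _ _ = refl
orderIso-increasing (a ∷ τ) (b ∷ u) h l with ∧-true⁻ (allᵇ (a <ᵇ_) τ) h
... | h1 , h2 rewrite agreeWith-increasing a b τ u h1 (suc-injective l) | orderIso-increasing τ u h2 (suc-injective l) =
    refl

applyUpTo-above-head : ∀ (f : ℕ → ℕ) n → (∀ {i j} → i < j → f i < f j) → ∀ {x} → x ∈ applyUpTo (λ i → f (suc i)) n
  → (f 0 <ᵇ x) ≡ true
applyUpTo-above-head f n mono m with ∈-applyUpTo⁻ (λ i → f (suc i)) m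
... | i , _ , refl = <ᵇ-true (mono (s≤s z≤n))

increasing-applyUpTo : ∀ (f : ℕ → ℕ) n → (∀ {i j} → i < j → f i < f j) → increasingᵇ (applyUpTo f n) ≡ true
increasing-applyUpTo f zero mono = refl
increasing-applyUpTo f (suc n) mono
  rewrite allᵇ⁺ {p = f 0 <ᵇ_} {xs = applyUpTo (λ i → f (suc i)) n} (applyUpTo-above-head f n mono)
  = increasing-applyUpTo (λ i → f (suc i)) n (λ lt → mono (s≤s lt))

aboveᵇ : Maybe ℕ → ℕ → Bool
aboveᵇ nothing _ = true
aboveᵇ (just b) x = b <ᵇ x

allAboveᵇ : Maybe ℕ → List ℕ → Bool
allAboveᵇ nothing _ = true
allAboveᵇ (just b) u = allᵇ (b <ᵇ_) u

-- With bound just b only subsequences all of whose entries exceed b are counted.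
incsAbove : Maybe ℕ → ℕ → List ℕ → ℕ
incsAbove b zero _ = 1
incsAbove b (suc k) [] = 0
incsAbove b (suc k) (x ∷ xs) = (if aboveᵇ b x then incsAbove (just x) k xs else 0) + incsAbove b (suc k) xs

incs : ℕ → List ℕ → ℕ
incs = incsAbove nothing

countSubseqs-increasing : ∀ b k xs → countSubseqs (λ u → allAboveᵇ b u ∧ increasingᵇ u) k xs ≡ incsAbove b k xs

countSubseqs-increasing-∷ : ∀ b k x xs → countSubseqs (λ u → allAboveᵇ b (x ∷ u) ∧ increasingᵇ (x ∷ u)) k xs
  ≡ (if aboveᵇ b x then incsAbove (just x) k xs else 0)
countSubseqs-increasing-∷ nothing k x xs = countSubseqs-increasing (just x) k xs
countSubseqs-increasing-∷ (just b') k x xs with b' <ᵇ x in e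
... | false = countᵇ-none (subseqs k xs) (λ _ → refl)
... | true = trans (countᵇ-cong (subseqs k xs) (λ {u} _ → pw u)) (countSubseqs-increasing (just x) k xs)
  where
  pw : ∀ u → (allᵇ (b' <ᵇ_) u ∧ (allᵇ (x <ᵇ_) u ∧ increasingᵇ u)) ≡ (allᵇ (x <ᵇ_) u ∧ increasingᵇ u)
  pw u with allᵇ (x <ᵇ_) u in h
  ... | true rewrite allᵇ-<ᵇ-weaken u (<ᵇ-true⁻ e) h = refl
  ... | false with allᵇ (b' <ᵇ_) u
  ... | true = refl
  ... | false = refl

countSubseqs-increasing nothing zero xs = refl
countSubseqs-increasing (just b) zero xs = refl
countSubseqs-increasing b (suc k) [] = refl
countSubseqs-increasing b (suc k) (x ∷ xs) =
  trans (countSubseqs-∷ (λ u → allAboveᵇ b u ∧ increasingᵇ u) k x xs)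
        (cong₂ _+_ (countSubseqs-increasing-∷ b k x xs) (countSubseqs-increasing b (suc k) xs))

occurrences-increasing : ∀ k π → occurrences (increasing k) π ≡ incs k π
occurrences-increasing k π = begin
  countᵇ (orderIsoᵇ (increasing k)) (subseqs (length (increasing k)) π)
    ≡⟨ cong (λ m → countSubseqs (orderIsoᵇ (increasing k)) m π) length-increasing ⟩
  countSubseqs (orderIsoᵇ (increasing k)) k π
    ≡⟨ countᵇ-cong (subseqs k π) (λ {u} m → orderIso-increasing (increasing k) u
         (increasing-applyUpTo suc k s≤s) (trans (proj₂ (∈-subseqs⇒⊑ k π m)) (sym length-increasing))) ⟩
  countSubseqs (λ u → allAboveᵇ nothing u ∧ increasingᵇ u) k π
    ≡⟨ countSubseqs-increasing nothing k π ⟩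
  incs k π ∎
  where
  open ≡-Reasoning
  length-increasing : length (increasing k) ≡ k
  length-increasing = length-applyUpTo suc k

incsAbove-dominated : ∀ x k ys → (∀ {y} → y ∈ ys → y ≤ x) → incsAbove (just x) (suc k) ys ≡ 0
incsAbove-dominated x k [] h = refl
incsAbove-dominated x k (y ∷ ys) h rewrite <ᵇ-false {x} {y} (h (here refl)) = incsAbove-dominated x k ys
    (λ m → h (there m))

incsAbove-++ : ∀ b k xs ys → (∀ {x y} → x ∈ xs → y ∈ ys → y < x) → incsAbove b (suc k) (xs ++ ys)
  ≡ incsAbove b (suc k) xs + incsAbove b (suc k) ys
incsAbove-++ b k [] ys h = refl
incsAbove-++ b k (x ∷ xs) ys h =
  trans (cong₂ _+_ starting-at-x (incsAbove-++ b k xs ys (λ a c → h (there a) c)))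
        (sym (+-assoc (if aboveᵇ b x then incsAbove (just x) k xs else 0) (incsAbove b (suc k) xs)
            (incsAbove b (suc k) ys)))
  where
  ys-too-small : ∀ k → incsAbove (just x) k (xs ++ ys) ≡ incsAbove (just x) k xs
  ys-too-small zero = refl
  ys-too-small (suc k') = trans (incsAbove-++ (just x) k' xs ys (λ a c → h (there a) c))
    (trans (cong (λ n → incsAbove (just x) (suc k') xs + n) (incsAbove-dominated x k' ys (λ m → <⇒≤ (h (here refl) m))))
           (+-identityʳ _))

  starting-at-x : (if aboveᵇ b x then incsAbove (just x) k (xs ++ ys) else 0)
    ≡ (if aboveᵇ b x then incsAbove (just x) k xs else 0)
  starting-at-x with aboveᵇ b x
  ... | true = ys-too-small k
  ... | false = refl

incsAbove-∷ʳ-max : ∀ b k xs N → aboveᵇ b N ≡ true → (∀ {x} → x ∈ xs → x < N) → incsAbove b (suc k) (xs ++ [ N ])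
  ≡ incsAbove b (suc k) xs + incsAbove b k xs
incsAbove-∷ʳ-max b zero [] N g h rewrite g = refl
incsAbove-∷ʳ-max b (suc k) [] N g h rewrite g = refl
incsAbove-∷ʳ-max b k (x ∷ xs) N g h with aboveᵇ b x in gx
incsAbove-∷ʳ-max b zero (x ∷ xs) N g h | true =
  cong suc (incsAbove-∷ʳ-max b zero xs N g (λ m → h (there m)))
incsAbove-∷ʳ-max b (suc k) (x ∷ xs) N g h | true =
  trans (cong₂ _+_ (incsAbove-∷ʳ-max (just x) k xs N (<ᵇ-true (h (here refl))) (λ m → h (there m)))
      (incsAbove-∷ʳ-max b (suc k) xs N g (λ m → h (there m))))
        (trans (interchange (incsAbove (just x) (suc k) xs) (incsAbove (just x) k xs) (incsAbove b (suc (suc k)) xs)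
            (incsAbove b (suc k) xs))
               (cong (λ t → (incsAbove (just x) (suc k) xs + incsAbove b (suc (suc k)) xs) +
                   (t + incsAbove b (suc k) xs)) (sym (if-true gx))))
incsAbove-∷ʳ-max b zero (x ∷ xs) N g h | false = incsAbove-∷ʳ-max b zero xs N g (λ m → h (there m))
incsAbove-∷ʳ-max b (suc k) (x ∷ xs) N g h | false =
  trans (incsAbove-∷ʳ-max b (suc k) xs N g (λ m → h (there m)))
        (cong (λ n → incsAbove b (suc (suc k)) xs + n) (sym (cong (_+ incsAbove b (suc k) xs) (if-false gx))))

shiftBound : ℕ → Maybe ℕ → Maybe ℕ
shiftBound s nothing = nothing
shiftBound s (just b) = just (b + s)

aboveᵇ-shift : ∀ b x s → aboveᵇ (shiftBound s b) (x + s) ≡ aboveᵇ b x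
aboveᵇ-shift nothing x s = refl
aboveᵇ-shift (just b) x s = <ᵇ-+ʳ b x s

incsAbove-shift : ∀ s b k xs → incsAbove (shiftBound s b) k (map (_+ s) xs) ≡ incsAbove b k xs
incsAbove-shift s b zero xs = refl
incsAbove-shift s b (suc k) [] = refl
incsAbove-shift s b (suc k) (x ∷ xs) rewrite aboveᵇ-shift b x s with aboveᵇ b x
... | true = cong₂ _+_ (incsAbove-shift s (just x) k xs) (incsAbove-shift s b (suc k) xs)
... | false = incsAbove-shift s b (suc k) xs

incs-1 : ∀ xs → incs 1 xs ≡ length xs
incs-1 [] = refl
incs-1 (x ∷ xs) = cong suc (incs-1 xs)

incsAbove-0-suc : ∀ b k xs → incsAbove b (suc k) xs ≡ 0 → incsAbove b (suc (suc k)) xs ≡ 0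
incsAbove-0-suc b k [] e = refl
incsAbove-0-suc b k (x ∷ xs) e with aboveᵇ b x
... | false = incsAbove-0-suc b k xs e
incsAbove-0-suc b zero (x ∷ xs) () | true
incsAbove-0-suc b (suc k) (x ∷ xs) e | true
  rewrite incsAbove-0-suc (just x) k xs (m+n≡0⇒m≡0 _ e) | incsAbove-0-suc b (suc k) xs (m+n≡0⇒n≡0 _ e) = refl

aboveᵇ-trans : ∀ b x y → aboveᵇ b x ≡ true → (x <ᵇ y) ≡ true → aboveᵇ b y ≡ true
aboveᵇ-trans nothing x y _ _ = refl
aboveᵇ-trans (just b) x y g h = <ᵇ-true {b} {y} (<-trans (<ᵇ-true⁻ {b} {x} g) (<ᵇ-true⁻ {x} {y} h))

incsAbove-mono : ∀ b x k xs → aboveᵇ b x ≡ true → incsAbove (just x) k xs ≤ incsAbove b k xs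
incsAbove-mono b x zero xs g = ≤-refl
incsAbove-mono b x (suc k) [] g = ≤-refl
incsAbove-mono b x (suc k) (y ∷ ys) g = +-mono-≤ starting-at-y (incsAbove-mono b x (suc k) ys g)
  where
  starting-at-y : (if x <ᵇ y then incsAbove (just y) k ys else 0) ≤ (if aboveᵇ b y then incsAbove (just y) k ys else 0)
  starting-at-y with x <ᵇ y in e
  ... | false = z≤n
  ... | true rewrite aboveᵇ-trans b x y g e = ≤-refl

incsAbove-1-suc : ∀ b k xs → incsAbove b (suc k) xs ≡ 1 → incsAbove b (suc (suc k)) xs ≡ 0
incsAbove-1-suc b k [] ()
incsAbove-1-suc b k (x ∷ xs) e with aboveᵇ b x in gx
... | false = incsAbove-1-suc b k xs e
... | true with m+n≡1⇒ (incsAbove (just x) k xs) (incsAbove b (suc k) xs) e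
incsAbove-1-suc b zero (x ∷ xs) e | true | inj₁ (() , _)
incsAbove-1-suc b (suc k) (x ∷ xs) e | true | inj₁ (e1 , e2) rewrite incsAbove-0-suc (just x) k xs e1 | incsAbove-1-suc
    b (suc k) xs e2 = refl
incsAbove-1-suc b zero (x ∷ xs) e | true | inj₂ (e1 , e2) rewrite incsAbove-0-suc b zero xs e2 =
  trans (+-identityʳ _) (n≤0⇒n≡0 (subst (incsAbove (just x) 1 xs ≤_) e2 (incsAbove-mono b x 1 xs gx)))
incsAbove-1-suc b (suc k) (x ∷ xs) e | true | inj₂ (e1 , e2) rewrite incsAbove-1-suc (just x) k xs e1 | incsAbove-0-suc
    b (suc k) xs e2 = refl


-- Alternating permutations

altUp-shift : ∀ s xs → altUp (map (_+ s) xs) ≡ altUp xs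
altDown-shift : ∀ s xs → altDown (map (_+ s) xs) ≡ altDown xs
altUp-shift s [] = refl
altUp-shift s (a ∷ []) = refl
altUp-shift s (a ∷ bxs@(b ∷ xs)) = cong₂ _∧_ (<ᵇ-+ʳ a b s) (altDown-shift s bxs)
altDown-shift s [] = refl
altDown-shift s (a ∷ []) = refl
altDown-shift s (a ∷ bxs@(b ∷ xs)) = cong₂ _∧_ (<ᵇ-+ʳ b a s) (altUp-shift s bxs)

altUp-++-below : ∀ {xs} c rest → Even xs → altUp xs ≡ true → (∀ {x} → x ∈ xs → c < x) → altUp (c ∷ rest) ≡ true
  → altUp (xs ++ c ∷ rest) ≡ true
altUp-++-below c rest even[] _ _ h = h
altUp-++-below {a ∷ b ∷ []} c rest (even∷ even[]) h lt hr with ∧-true⁻ (a <ᵇ b) h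
... | h1 , _ = ∧-true⁺ h1 (∧-true⁺ (<ᵇ-true (lt (there (here refl)))) hr)
altUp-++-below {a ∷ b ∷ e ∷ xs} c rest (even∷ ev) h lt hr with ∧-true⁻ (a <ᵇ b) h
... | h1 , h2 with ∧-true⁻ (e <ᵇ b) h2
... | h3 , h4 = ∧-true⁺ h1 (∧-true⁺ h3 (altUp-++-below c rest ev h4 (λ m → lt (there (there m))) hr))

altUp-++⁻ : ∀ xs ys → altUp (xs ++ ys) ≡ true → altUp xs ≡ true
altDown-++⁻ : ∀ xs ys → altDown (xs ++ ys) ≡ true → altDown xs ≡ true
altUp-++⁻ [] ys h = refl
altUp-++⁻ (a ∷ []) ys h = refl
altUp-++⁻ (a ∷ bxs@(b ∷ xs)) ys h = ∧-true⁺ (proj₁ (∧-true⁻ (a <ᵇ b) h))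
    (altDown-++⁻ bxs ys (proj₂ (∧-true⁻ (a <ᵇ b) h)))
altDown-++⁻ [] ys h = refl
altDown-++⁻ (a ∷ []) ys h = refl
altDown-++⁻ (a ∷ bxs@(b ∷ xs)) ys h = ∧-true⁺ (proj₁ (∧-true⁻ (b <ᵇ a) h))
    (altUp-++⁻ bxs ys (proj₂ (∧-true⁻ (b <ᵇ a) h)))

altUp-max-head : ∀ N β → (∀ {y} → y ∈ β → y < N) → β ≢ [] → altUp (N ∷ β) ≡ true → ⊥
altUp-max-head N [] _ ne _ = ne refl
altUp-max-head N (b ∷ β) lt _ h with trans (sym (<ᵇ-false {N} {b} (<⇒≤ (lt (here refl))))) (proj₁ (∧-true⁻ (N <ᵇ b) h))
... | ()

altDown⇒altUp-tail : ∀ N β → altDown (N ∷ β) ≡ true → altUp β ≡ true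
altDown⇒altUp-tail N [] _ = refl
altDown⇒altUp-tail N (b ∷ β) h = proj₂ (∧-true⁻ (b <ᵇ N) h)

EndsAbove : List ℕ → ℕ → Set
EndsAbove xs c = xs ≡ [] ⊎ (∃₂ λ α3 d → xs ≡ α3 ++ [ d ] × c < d)

split-before-max : ∀ N α β → α ≢ [] → altUp (α ++ N ∷ β) ≡ true → (∀ {x} → x ∈ α → x < N) →
  ∃₂ λ α'' c → α ≡ α'' ++ [ c ] × Even α'' × altUp α'' ≡ true × EndsAbove α'' c × altDown (N ∷ β) ≡ true
split-before-max N [] β ne h lt = ⊥-elim (ne refl)
split-before-max N (c ∷ []) β ne h lt = [] , c , refl , even[] , refl , inj₁ refl , proj₂ (∧-true⁻ (c <ᵇ N) h)
split-before-max N (a ∷ b ∷ []) β ne h lt with ∧-true⁻ (a <ᵇ b) h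
... | _ , h2 with trans (sym (<ᵇ-false {N} {b} (<⇒≤ (lt (there (here refl)))))) (proj₁ (∧-true⁻ (N <ᵇ b) h2))
... | ()
split-before-max N (a ∷ b ∷ rxs@(r ∷ rest)) β ne h lt = extend
    (split-before-max N rxs β (λ ()) altUp-rxs (λ m → lt (there (there m))))
  where
  a<b : (a <ᵇ b) ≡ true
  a<b = proj₁ (∧-true⁻ (a <ᵇ b) h)

  r<b : (r <ᵇ b) ≡ true
  r<b = proj₁ (∧-true⁻ (r <ᵇ b) (proj₂ (∧-true⁻ (a <ᵇ b) h)))

  altUp-rxs : altUp (rxs ++ N ∷ β) ≡ true
  altUp-rxs = proj₂ (∧-true⁻ (r <ᵇ b) (proj₂ (∧-true⁻ (a <ᵇ b) h)))

  extend : (∃₂ λ α'' c → rxs ≡ α'' ++ [ c ] × Even α'' × altUp α'' ≡ true × EndsAbove α'' c × altDown (N ∷ β) ≡ true) →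
       ∃₂ λ α'' c → a ∷ b ∷ rxs ≡ α'' ++ [ c ] × Even α'' × altUp α'' ≡ true × EndsAbove α'' c × altDown (N ∷ β) ≡ true
  extend ([] , c , refl , ev , alt , lg , ad) = a ∷ b ∷ [] , c , refl , even∷ even[] , ∧-true⁺ a<b refl , inj₂
      (a ∷ [] , b , refl , <ᵇ-true⁻ {r} {b} r<b) , ad
  extend ((e ∷ αr) , c , eq , ev , alt , lg , ad) =
    a ∷ b ∷ e ∷ αr , c , cong (λ t → a ∷ b ∷ t) eq , even∷ ev , ∧-true⁺ a<b
        (∧-true⁺ (subst (λ t → (t <ᵇ b) ≡ true) (LP.∷-injectiveˡ eq) r<b) alt) , ends-above lg , ad
    where
    ends-above : EndsAbove (e ∷ αr) c → EndsAbove (a ∷ b ∷ e ∷ αr) c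
    ends-above (inj₁ ())
    ends-above (inj₂ (α3 , d , eq3 , cd)) = inj₂ (a ∷ b ∷ α3 , d , cong (λ t → a ∷ b ∷ t) eq3 , cd)

split-last-descent : ∀ a rest → Even rest → rest ≢ [] → altUp (a ∷ rest) ≡ true → ∃₂ λ ρ d → ∃ λ e → a ∷ rest
  ≡ ρ ++ d ∷ e ∷ [] × e < d
split-last-descent a [] even[] ne h = ⊥-elim (ne refl)
split-last-descent a (b ∷ c ∷ []) (even∷ even[]) ne h = a ∷ [] , b , c , refl , <ᵇ-true⁻ {c} {b}
    (proj₁ (∧-true⁻ (c <ᵇ b) (proj₂ (∧-true⁻ (a <ᵇ b) h))))
split-last-descent a (b ∷ c ∷ rest'@(x ∷ y)) (even∷ ev) ne h with split-last-descent c rest' ev (λ ())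
    (proj₂ (∧-true⁻ (c <ᵇ b) (proj₂ (∧-true⁻ (a <ᵇ b) h))))
... | ρ , d , e , eq , ed = a ∷ b ∷ ρ , d , e , cong (λ t → a ∷ b ∷ t) eq , ed


-- Alternating 132-avoiding permutations

IsAltAv : ℕ → List ℕ → Set
IsAltAv n π = IsPerm n π × altUp π ≡ true × Avoids132 π

isAltAvᵇ : List ℕ → Bool
isAltAvᵇ π = altUp π ∧ (occurrences pat132 π ≡ᵇ 0)

AltAv : ℕ → List (List ℕ)
AltAv n = filterᵇ isAltAvᵇ (perms n)

unique-AltAv : ∀ n → Unique (AltAv n)
unique-AltAv n = unique-filterᵇ (unique-perms n)

∈-AltAv⁻ : ∀ {n π} → π ∈ AltAv n → IsAltAv n π
∈-AltAv⁻ {n} {π} m with ∈-filterᵇ⁻ {xs = perms n} m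
... | pm , g with ∧-true⁻ (altUp π) g
... | g1 , g2 = ∈-perms⁻ pm , g1 , occurrences132≡0⇒avoids π (≡ᵇ⇒≡ _ 0 (≡true⇒T g2))

∈-AltAv⁺ : ∀ {n π} → IsAltAv n π → π ∈ AltAv n
∈-AltAv⁺ {n} {π} (pp , al , av) = ∈-filterᵇ⁺ (∈-perms⁺ pp)
    (∧-true⁺ al (T⇒≡true (≡⇒≡ᵇ _ 0 (avoids⇒occurrences132≡0 π av))))

∈-AltAv⇒IsAltAv : ∀ {n π} → π ∈ AltAv n → IsAltAv (length π) π
∈-AltAv⇒IsAltAv {n} {π} m with ∈-AltAv⁻ {n} m
... | g = subst (λ t → IsAltAv t π) (sym (proj₁ (proj₂ (proj₁ g)))) g

∈-AltAv⇒length : ∀ {n π} → π ∈ AltAv n → length π ≡ n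
∈-AltAv⇒length {n} m = proj₁ (proj₂ (proj₁ (∈-AltAv⁻ {n} m)))

∈-AltAv-double⇒Even : ∀ {i p} → p ∈ AltAv (i + i) → Even p
∈-AltAv-double⇒Even {i} {p} pm = length-double⇒Even i p (∈-AltAv⇒length {i + i} pm)

IsAltAv-[] : IsAltAv 0 []
IsAltAv-[] = ([] , refl , []) , refl , (λ s _ _ → absurd (⊑-length s))
  where
  absurd : ∀ {A : Set} → 3 ≤ 0 → A
  absurd ()

-- Every alternating 132-avoiding permutation of positive even length has this shape
-- (decompose-even); its maximum sits between the two blocks.
glue : List ℕ → List ℕ → List ℕ
glue p q = map (_+ suc (length q)) p ++ suc (length q) ∷ suc (suc (length p + length q)) ∷ q

appendOne : List ℕ → List ℕ
appendOne p = map (_+ 1) p ++ [ 1 ]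

module Glue (p q : List ℕ) (gp : IsAltAv (length p) p) (gq : IsAltAv (length q) q) (evp : Even p) where
  lp lq s N : ℕ
  lp = length p
  lq = length q
  s = suc lq
  N = suc (suc (lp + lq))

  L : List ℕ
  L = map (_+ s) p

  p-range : ∀ {v} → v ∈ p → InRange lp v
  p-range m = All.lookup (proj₂ (proj₂ (proj₁ gp))) m

  q-range : ∀ {v} → v ∈ q → InRange lq v
  q-range m = All.lookup (proj₂ (proj₂ (proj₁ gq))) m

  s<N : s < N
  s<N = s≤s (s≤s (m≤n+m lq lp))

  q<s : ∀ {y} → y ∈ q → y < s
  q<s m = s≤s (proj₂ (q-range m))

  q<N : ∀ {y} → y ∈ q → y < N
  q<N m = <-trans (q<s m) s<N

  L-range : ∀ {x} → x ∈ L → s < x × x < N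
  L-range m with ∈-map⁻ (_+ s) m
  ... | v , vm , refl = +-monoˡ-< s (proj₁ (p-range vm)) ,
        s≤s (subst (λ t → v + s ≤ t) (+-suc lp lq) (+-monoˡ-≤ s (proj₂ (p-range vm))))

  unique : Unique (glue p q)
  unique = Unique-++⁺ (unique-shift s (proj₁ (proj₁ gp)))
           (All.tabulate (λ { (here refl) e → <-irrefl e s<N ; (there m) e → <-irrefl (sym e) (q<s m) }) ∷
            (All.tabulate (λ m e → <-irrefl (sym e) (q<N m)) ∷ proj₁ (proj₁ gq)))
           dj
    where
    dj : ∀ {z} → z ∈ L → z ∈ s ∷ N ∷ q → ⊥
    dj zm (here refl) = <-irrefl refl (proj₁ (L-range zm))
    dj zm (there (here refl)) = <-irrefl refl (proj₂ (L-range zm))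
    dj zm (there (there m)) = <-asym (q<s m) (proj₁ (L-range zm))

  length-glue : length (glue p q) ≡ N
  length-glue = trans (length-++ L)
      (trans (cong (_+ suc (suc lq)) (length-map (_+ s) p)) (trans (+-suc lp (suc lq)) (cong suc (+-suc lp lq))))

  in-range : All (InRange N) (glue p q)
  in-range = All.tabulate range
    where
    range : ∀ {x} → x ∈ glue p q → InRange N x
    range m with ∈-++⁻ L m
    ... | inj₁ a = <-trans (s≤s z≤n) (proj₁ (L-range a)) , <⇒≤ (proj₂ (L-range a))
    ... | inj₂ (here refl) = s≤s z≤n , <⇒≤ s<N
    ... | inj₂ (there (here refl)) = s≤s z≤n , ≤-refl
    ... | inj₂ (there (there b)) = proj₁ (q-range b) , <⇒≤ (q<N b)

  altDown-N∷q : altDown (N ∷ q) ≡ true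
  altDown-N∷q = altDown-max∷ q q<N (proj₁ (proj₂ gq))
    where
    altDown-max∷ : ∀ r → (∀ {y} → y ∈ r → y < N) → altUp r ≡ true → altDown (N ∷ r) ≡ true
    altDown-max∷ [] _ _ = refl
    altDown-max∷ (y ∷ r) h a = ∧-true⁺ (<ᵇ-true (h (here refl))) a

  alternating : altUp (glue p q) ≡ true
  alternating = altUp-++-below s (N ∷ q) (Even-map _ evp) (trans (altUp-shift s p) (proj₁ (proj₂ gp)))
      (λ m → proj₁ (L-range m))
          (∧-true⁺ (<ᵇ-true s<N) altDown-N∷q)

  assoc : ((L ++ [ s ]) ++ [ N ]) ++ q ≡ glue p q
  assoc = trans (++-assoc (L ++ [ s ]) [ N ] q) (++-assoc L [ s ] (N ∷ q))

  L∷s<N : ∀ {x} → x ∈ L ++ [ s ] → x < N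
  L∷s<N m with ∈-++⁻ L m
  ... | inj₁ a = proj₂ (L-range a)
  ... | inj₂ (here refl) = s<N

  cross : ∀ {x y} → x ∈ (L ++ [ s ]) ++ [ N ] → y ∈ q → y < x
  cross xm ym with ∈-++⁻ (L ++ [ s ]) xm
  ... | inj₂ (here refl) = q<N ym
  ... | inj₁ a with ∈-++⁻ L a
  ... | inj₁ b = <-trans (q<s ym) (proj₁ (L-range b))
  ... | inj₂ (here refl) = q<s ym

  avoids : Avoids132 (glue p q)
  avoids = subst Avoids132 assoc
         (Avoids132-++-above ((L ++ [ s ]) ++ [ N ]) q
            (Avoids132-∷ʳ-max (L ++ [ s ]) N
                (Avoids132-++-above L [ s ] (Avoids132-shift⁺ s p (proj₂ (proj₂ gp))) (Avoids132-[x] s)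
                (λ { xm (here refl) → proj₁ (L-range xm) })) L∷s<N)
            (proj₂ (proj₂ gq)) cross)

  isAltAv : IsAltAv N (glue p q)
  isAltAv = (unique , length-glue , in-range) , alternating , avoids

  s-below-L : ∀ {x y} → x ∈ L → y ∈ [ s ] → y < x
  s-below-L xm (here refl) = proj₁ (L-range xm)

  incs-L : ∀ k → incs k L ≡ incs k p
  incs-L k = incsAbove-shift s nothing k p

  incs-1-L∷s : incs 1 (L ++ [ s ]) ≡ incs 1 p + 1
  incs-1-L∷s = trans (incsAbove-++ nothing 0 L [ s ] s-below-L) (cong (_+ 1) (incs-L 1))

  incs-L∷s : ∀ k → incs (suc (suc k)) (L ++ [ s ]) ≡ incs (suc (suc k)) p + 0
  incs-L∷s k = trans (incsAbove-++ nothing (suc k) L [ s ] s-below-L) (cong (_+ 0) (incs-L (suc (suc k))))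

  -- No increasing subsequence passes from the first block into q, and N extends every one in L ++ [ s ].
  incs-glue : ∀ k → incs (suc k) (glue p q) ≡ (incs (suc k) (L ++ [ s ]) + incs k (L ++ [ s ])) + incs (suc k) q
  incs-glue k = trans (cong (incs (suc k)) (sym assoc))
             (trans (incsAbove-++ nothing k ((L ++ [ s ]) ++ [ N ]) q cross)
               (cong (_+ incs (suc k) q) (incsAbove-∷ʳ-max nothing k (L ++ [ s ]) N refl L∷s<N)))

  incs-glue-≥3 : ∀ t → incs (suc (suc (suc t))) (glue p q)
    ≡ (incs (suc (suc (suc t))) p + incs (suc (suc t)) p) + incs (suc (suc (suc t))) q
  incs-glue-≥3 t = trans (incs-glue (suc (suc t))) (cong (_+ incs (suc (suc (suc t))) q)
             (cong₂ _+_ (trans (incs-L∷s (suc t)) (+-identityʳ _)) (trans (incs-L∷s t) (+-identityʳ _))))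

  incs-glue-2 : incs 2 (glue p q) ≡ (incs 2 p + (incs 1 p + 1)) + incs 2 q
  incs-glue-2 = trans (incs-glue 1) (cong (_+ incs 2 q) (cong₂ _+_ (trans (incs-L∷s 0) (+-identityʳ _)) incs-1-L∷s))

glue-IsAltAv : ∀ p q → IsAltAv (length p) p → IsAltAv (length q) q → Even p
  → IsAltAv (suc (suc (length p + length q))) (glue p q)
glue-IsAltAv p q gp gq evp = Glue.isAltAv p q gp gq evp

module AppendOne (p : List ℕ) (gp : IsAltAv (length p) p) (evp : Even p) where
  lp : ℕ
  lp = length p

  L : List ℕ
  L = map (_+ 1) p

  L-range : ∀ {x} → x ∈ L → 1 < x × x ≤ suc lp
  L-range m with ∈-map⁻ (_+ 1) m
  ... | v , vm , refl with All.lookup (proj₂ (proj₂ (proj₁ gp))) vm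
  ... | v0 , vl = +-monoˡ-< 1 v0 , subst (v + 1 ≤_) (+-comm lp 1) (+-monoˡ-≤ 1 vl)

  isAltAv : IsAltAv (suc lp) (appendOne p)
  isAltAv = (Unique-++⁺ (unique-shift 1 (proj₁ (proj₁ gp))) ([] ∷ [])
      (λ { zm (here refl) → <-irrefl refl (proj₁ (L-range zm)) }) ,
          trans (length-++ L) (trans (cong (_+ 1) (length-map (_+ 1) p)) (+-comm lp 1)) ,
          All.tabulate in-range) ,
         altUp-++-below 1 [] (Even-map _ evp) (trans (altUp-shift 1 p) (proj₁ (proj₂ gp))) (λ m → proj₁ (L-range m))
             refl ,
         Avoids132-++-above L [ 1 ] (Avoids132-shift⁺ 1 p (proj₂ (proj₂ gp))) (Avoids132-[x] 1)
             (λ { xm (here refl) → proj₁ (L-range xm) })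
    where
    in-range : ∀ {x} → x ∈ appendOne p → InRange (suc lp) x
    in-range m with ∈-++⁻ L m
    ... | inj₁ a = <-trans (s≤s z≤n) (proj₁ (L-range a)) , proj₂ (L-range a)
    ... | inj₂ (here refl) = s≤s z≤n , s≤s z≤n

appendOne-IsAltAv : ∀ p → IsAltAv (length p) p → Even p → IsAltAv (suc (length p)) (appendOne p)
appendOne-IsAltAv p gp evp = AppendOne.isAltAv p gp evp


-- Decomposition

module AroundMax (n0 : ℕ) (α β : List ℕ) (g : IsAltAv (suc (suc n0)) (α ++ suc (suc n0) ∷ β)) where
  N : ℕ
  N = suc (suc n0)

  π : List ℕ
  π = α ++ N ∷ β

  unique-π : Unique π
  unique-π = proj₁ (proj₁ g)

  length-π : length π ≡ N
  length-π = proj₁ (proj₂ (proj₁ g))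

  alternating-π : altUp π ≡ true
  alternating-π = proj₁ (proj₂ g)

  avoids-π : Avoids132 π
  avoids-π = proj₂ (proj₂ g)

  π-range : ∀ {x} → x ∈ π → InRange N x
  π-range m = All.lookup (proj₂ (proj₂ (proj₁ g))) m

  unique-α : Unique α
  unique-α = proj₁ (Unique-++⁻ α unique-π)

  unique-N∷β : Unique (N ∷ β)
  unique-N∷β = proj₁ (proj₂ (Unique-++⁻ α unique-π))

  α-disjoint : ∀ {z} → z ∈ α → z ∈ N ∷ β → ⊥
  α-disjoint = proj₂ (proj₂ (Unique-++⁻ α unique-π))

  unique-β : Unique β
  unique-β with unique-N∷β
  ... | _ ∷ u = u

  N∉β : N ∉ β
  N∉β with unique-N∷β
  ... | px ∷ _ = All¬⇒¬Any px

  α<N : ∀ {x} → x ∈ α → x < N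
  α<N m with m≤n⇒m<n∨m≡n (proj₂ (π-range (∈-++⁺ˡ m)))
  ... | inj₁ lt = lt
  ... | inj₂ refl = ⊥-elim (α-disjoint m (here refl))

  β<N : ∀ {y} → y ∈ β → y < N
  β<N m with m≤n⇒m<n∨m≡n (proj₂ (π-range (∈-++⁺ʳ α (there m))))
  ... | inj₁ lt = lt
  ... | inj₂ refl = ⊥-elim (N∉β m)

  α≢[] : α ≢ []
  α≢[] e = altUp-max-head N β β<N β≢[] (subst (λ t → altUp (t ++ N ∷ β) ≡ true) e alternating-π)
    where
    β≢[] : β ≢ []
    β≢[] eb with trans (sym length-π) (subst (λ t → length (t ++ N ∷ β) ≡ 1) (sym e) (cong (λ t → suc (length t)) eb))
    ... | ()

  β<α : ∀ {x y} → x ∈ α → y ∈ β → y < x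
  β<α {x} {y} xm ym with <-cmp x y
  ... | tri> _ _ x>y = x>y
  ... | tri≈ _ refl _ = ⊥-elim (α-disjoint xm (there ym))
  ... | tri< lt _ _ = ⊥-elim (avoids-π (∈-∷-⊑-++ (N ∷ β) xm (keep (∈⇒[x]⊑ ym))) lt (β<N ym))

++-∷ʳ-∷ʳ : ∀ (α3 : List ℕ) d c rest → ((α3 ++ [ d ]) ++ [ c ]) ++ rest ≡ α3 ++ d ∷ c ∷ rest
++-∷ʳ-∷ʳ α3 d c rest = trans (++-assoc (α3 ++ [ d ]) [ c ] rest) (++-assoc α3 [ d ] (c ∷ rest))

before-max-above-last : ∀ n0 α'' c β → IsAltAv (suc (suc n0)) ((α'' ++ [ c ]) ++ suc (suc n0) ∷ β) → EndsAbove α'' c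
  → ∀ {a} → a ∈ α'' → c < a
before-max-above-last n0 .[] c β g (inj₁ refl) ()
before-max-above-last n0 .(α3 ++ [ d ]) c β g (inj₂ (α3 , d , refl , cd)) {a} am with <-cmp a c
... | tri> _ _ x>y = x>y
... | tri≈ _ refl _ = ⊥-elim (α-disjoint am (here refl))
  where
  α-disjoint : ∀ {z} → z ∈ α3 ++ [ d ] → z ∈ [ c ] → ⊥
  α-disjoint = proj₂ (proj₂ (Unique-++⁻ (α3 ++ [ d ]) (AroundMax.unique-α n0 ((α3 ++ [ d ]) ++ [ c ]) β g)))
... | tri< lt _ _ with ∈-++⁻ α3 am
... | inj₂ (here refl) = ⊥-elim (<-asym lt cd)
... | inj₁ a3 = ⊥-elim (AroundMax.avoids-π n0 ((α3 ++ [ d ]) ++ [ c ]) β g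
        (subst ((a ∷ d ∷ c ∷ []) ⊑_) (sym (++-∷ʳ-∷ʳ α3 d c (suc (suc n0) ∷ β)))
            (∈-∷-⊑-++ (d ∷ c ∷ suc (suc n0) ∷ β) a3 (keep (keep done)))) lt cd)

IsGlue : List ℕ → Set
IsGlue π = ∃₂ λ p q → IsAltAv (length p) p × IsAltAv (length q) q × Even p × π ≡ glue p q

module Decompose (n0 : ℕ) (α'' : List ℕ) (c : ℕ) (β : List ℕ)
                 (g : IsAltAv (suc (suc n0)) ((α'' ++ [ c ]) ++ suc (suc n0) ∷ β))
                 (ev : Even α'') (al : altUp α'' ≡ true) (cmin : ∀ {a} → a ∈ α'' → c < a)
                 (alβ : altUp β ≡ true) where
  open AroundMax n0 (α'' ++ [ c ]) β g

  j : ℕ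
  j = length β

  c∈α : c ∈ α'' ++ [ c ]
  c∈α = ∈-++⁺ʳ α'' (here refl)

  β<c : ∀ {y} → y ∈ β → y < c
  β<c ym = β<α c∈α ym

  c<N : c < N
  c<N = α<N c∈α

  0<c : 0 < c
  0<c = proj₁ (π-range (∈-++⁺ˡ c∈α))

  j≤c∸1 : j ≤ c ∸ 1
  j≤c∸1 = subst (j ≤_) (length-applyUpTo suc (c ∸ 1))
      (unique-⊆⇒length≤ unique-β (λ ym → ∈-range⁺
      (proj₁ (π-range (∈-++⁺ʳ (α'' ++ [ c ]) (there ym))) , <⇒≤∸1 (β<c ym))))

  c∸1≤j : c ∸ 1 ≤ j
  c∸1≤j = subst (_≤ j) (length-applyUpTo suc (c ∸ 1)) (unique-⊆⇒length≤ (unique-range (c ∸ 1)) below-c-in-β)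
    where
    below-c-in-β : ∀ {v} → v ∈ applyUpTo suc (c ∸ 1) → v ∈ β
    below-c-in-β {v} vm with ∈-range⁻ vm
    ... | v0 , vle with ≤-<-trans vle (subst (c ∸ 1 <_) (sym (suc-∸1 0<c)) (n<1+n (c ∸ 1)))
      where
      suc-∸1 : ∀ {c} → 0 < c → c ≡ suc (c ∸ 1)
      suc-∸1 {suc c} _ = refl
    ... | v<c with ∈-++⁻ (α'' ++ [ c ]) (IsPerm-∈ (proj₁ g) (v0 , <⇒≤ (<-trans v<c c<N)))
    ... | inj₂ (there m) = m
    ... | inj₂ (here refl) = ⊥-elim (<-asym v<c c<N)
    ... | inj₁ m with ∈-++⁻ α'' m
    ... | inj₁ m' = ⊥-elim (<-asym v<c (cmin m'))
    ... | inj₂ (here refl) = ⊥-elim (<-irrefl refl v<c)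

  c≡1+j : c ≡ suc j
  c≡1+j = ∸1≡⇒ 0<c (≤-antisym c∸1≤j j≤c∸1)
    where
    ∸1≡⇒ : ∀ {c} → 0 < c → c ∸ 1 ≡ j → c ≡ suc j
    ∸1≡⇒ {suc c} _ e = cong suc e
  s : ℕ
  s = suc j

  p : List ℕ
  p = map (_∸ s) α''

  s<α'' : ∀ {a} → a ∈ α'' → s < a
  s<α'' m = subst (_< _) c≡1+j (cmin m)

  shift-p : map (_+ s) p ≡ α''
  shift-p = map-+-∸ s α'' (λ m → <⇒≤ (s<α'' m))

  length-p : length p ≡ length α''
  length-p = length-map (_∸ s) α''

  length-α'' : length α'' + 1 + s ≡ N
  length-α'' = trans (sym (trans (length-++ (α'' ++ [ c ])) (cong (_+ s) (length-++ α'')))) length-π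

  unique-α'' : Unique α''
  unique-α'' = proj₁ (Unique-++⁻ α'' unique-α)

  isAltAv-p : IsAltAv (length p) p
  isAltAv-p = (UP.map⁻ (subst Unique (sym shift-p) unique-α'') , refl , All.tabulate in-range) ,
          trans (sym (altUp-shift s p)) (trans (cong altUp shift-p) al) ,
          Avoids132-shift⁻ s p (subst Avoids132 (sym shift-p)
              (Avoids132-⊑ (⊑-++ˡ (N ∷ β) (⊑-++ˡ [ c ] (⊑-refl α''))) avoids-π))
    where
    N≡1+s+α'' : N ≡ suc (s + length α'')
    N≡1+s+α'' = trans (sym length-α'')
      (trans (+-comm (length α'' + 1) s) (trans (cong (λ n → s + n) (+-comm (length α'') 1)) (+-suc s (length α''))))
    in-range : ∀ {x} → x ∈ p → InRange (length p) x
    in-range m with ∈-map⁻ (_∸ s) m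
    ... | a , am , refl = m<n⇒0<n∸m (s<α'' am) ,
          subst (a ∸ s ≤_) (sym length-p) (m≤n+o⇒m∸n≤o a s (≤-pred (subst (a <_) N≡1+s+α'' (α<N (∈-++⁺ˡ am)))))

  isAltAv-β : IsAltAv (length β) β
  isAltAv-β = (unique-β , refl , All.tabulate
      (λ ym → proj₁ (π-range (∈-++⁺ʳ (α'' ++ [ c ]) (there ym))) , ≤-pred (subst (_ <_) c≡1+j (β<c ym)))) ,
          alβ , Avoids132-⊑ (⊑-++ʳ (α'' ++ [ c ]) (skip (⊑-refl β))) avoids-π

  N≡ : N ≡ suc (suc (length p + j))
  N≡ = trans (sym length-α'') (trans (cong (λ t → t + 1 + s) (sym length-p)) (+1+suc (length p) j))
    where
    +1+suc : ∀ a b → a + 1 + suc b ≡ suc (suc (a + b))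
    +1+suc a b = trans (+-suc (a + 1) b) (cong suc (trans (cong (_+ b) (+-comm a 1)) refl))

  isGlue : IsGlue π
  isGlue = p , β , isAltAv-p , isAltAv-β , Even-map _ ev ,
        trans (++-assoc α'' [ c ] (N ∷ β)) (cong₂ _++_ (sym shift-p) (cong₂ _∷_ c≡1+j (cong (_∷ β) N≡)))

decompose-at-max : ∀ n0 α β → IsAltAv (suc (suc n0)) (α ++ suc (suc n0) ∷ β) → IsGlue (α ++ suc (suc n0) ∷ β)
decompose-at-max n0 α β g with split-before-max (suc (suc n0)) α β (AroundMax.α≢[] n0 α β g)
    (AroundMax.alternating-π n0 α β g) (AroundMax.α<N n0 α β g)
... | α'' , c , refl , ev , al , lg , ad =
  Decompose.isGlue n0 α'' c β g ev al (before-max-above-last n0 α'' c β g lg) (altDown⇒altUp-tail (suc (suc n0)) β ad)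

decompose-even : ∀ n0 π → IsAltAv (suc (suc n0)) π → IsGlue π
decompose-even n0 π g with ∈-∃++ (IsPerm-∈ (proj₁ g) (s≤s z≤n , ≤-refl {suc (suc n0)}))
... | α , β , refl = decompose-at-max n0 α β g

decompose-appendOne : ∀ n ρ' → IsAltAv (suc n) (ρ' ++ [ 1 ]) → ∃ λ p → IsAltAv (length p) p × length p ≡ n × ρ' ++ [ 1 ]
  ≡ appendOne p
decompose-appendOne n ρ' g = p , isAltAv-p , trans length-p length-ρ' , cong (_++ [ 1 ]) (sym shift-p)
  where
  π : List ℕ
  π = ρ' ++ [ 1 ]

  π-range : ∀ {x} → x ∈ π → InRange (suc n) x
  π-range m = All.lookup (proj₂ (proj₂ (proj₁ g))) m

  ρ'-disjoint : ∀ {z} → z ∈ ρ' → z ∈ [ 1 ] → ⊥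
  ρ'-disjoint = proj₂ (proj₂ (Unique-++⁻ ρ' (proj₁ (proj₁ g))))

  unique-ρ' : Unique ρ'
  unique-ρ' = proj₁ (Unique-++⁻ ρ' (proj₁ (proj₁ g)))

  1<ρ' : ∀ {x} → x ∈ ρ' → 1 < x
  1<ρ' {x} m with m≤n⇒m<n∨m≡n (proj₁ (π-range (∈-++⁺ˡ m)))
  ... | inj₁ lt = lt
  ... | inj₂ refl = ⊥-elim (ρ'-disjoint m (here refl))
  p : List ℕ
  p = map (_∸ 1) ρ'

  shift-p : map (_+ 1) p ≡ ρ'
  shift-p = map-+-∸ 1 ρ' (λ m → <⇒≤ (1<ρ' m))

  length-p : length p ≡ length ρ'
  length-p = length-map (_∸ 1) ρ'

  length-ρ' : length ρ' ≡ n
  length-ρ' = suc-injective (trans (trans (+-comm 1 (length ρ')) (sym (length-++ ρ'))) (proj₁ (proj₂ (proj₁ g))))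

  isAltAv-p : IsAltAv (length p) p
  isAltAv-p = (UP.map⁻ (subst Unique (sym shift-p) unique-ρ') , refl , All.tabulate in-range) ,
          trans (sym (altUp-shift 1 p)) (trans (cong altUp shift-p) (altUp-++⁻ ρ' [ 1 ] (proj₁ (proj₂ g)))) ,
          Avoids132-shift⁻ 1 p (subst Avoids132 (sym shift-p) (Avoids132-⊑ (⊑-++ˡ [ 1 ] (⊑-refl ρ')) (proj₂ (proj₂ g))))
    where
    in-range : ∀ {x} → x ∈ p → InRange (length p) x
    in-range m with ∈-map⁻ (_∸ 1) m
    ... | a , am , refl = m<n⇒0<n∸m (1<ρ' am) , subst (a ∸ 1 ≤_) (sym (trans length-p length-ρ'))
        (m≤n+o⇒m∸n≤o a 1 (proj₂ (π-range (∈-++⁺ˡ am))))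

decompose-odd : ∀ m π → IsAltAv (suc (m + m)) π → ∃ λ p → IsAltAv (length p) p × Even p × π ≡ appendOne p
decompose-odd zero (x ∷ []) g with proj₂ (proj₂ (proj₁ g))
... | (s≤s z≤n , s≤s z≤n) ∷ [] = [] , IsAltAv-[] , even[] , refl
decompose-odd zero [] g with proj₁ (proj₂ (proj₁ g))
... | ()
decompose-odd zero (x ∷ y ∷ _) g with proj₁ (proj₂ (proj₁ g))
... | ()
decompose-odd (suc m) [] g with proj₁ (proj₂ (proj₁ g))
... | ()
decompose-odd (suc m) (a ∷ rest) g with split-last-descent a rest
    (length-double⇒Even (suc m) rest (suc-injective (proj₁ (proj₂ (proj₁ g))))) rest≢[] (proj₁ (proj₂ g))
  where
  rest≢[] : rest ≢ []
  rest≢[] refl with proj₁ (proj₂ (proj₁ g))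
  ... | ()
... | ρ , d , e , eq , ed = result
  where
  isAltAv-π : IsAltAv (suc (suc m + suc m)) (ρ ++ d ∷ e ∷ [])
  isAltAv-π = subst (IsAltAv _) eq g

  π-range : ∀ {x} → x ∈ ρ ++ d ∷ e ∷ [] → InRange (suc (suc m + suc m)) x
  π-range mm = All.lookup (proj₂ (proj₂ (proj₁ isAltAv-π))) mm

  ρ-disjoint : ∀ {z} → z ∈ ρ → z ∈ d ∷ e ∷ [] → ⊥
  ρ-disjoint = proj₂ (proj₂ (Unique-++⁻ ρ (proj₁ (proj₁ isAltAv-π))))

  e≡1 : e ≡ 1
  e≡1 with ∈-++⁻ ρ (IsPerm-∈ (proj₁ isAltAv-π) (s≤s z≤n , s≤s z≤n))
  ... | inj₂ (there (here refl)) = refl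
  ... | inj₂ (here refl) = ⊥-elim (<-irrefl refl (<-≤-trans ed (proj₁ (π-range (∈-++⁺ʳ ρ (there (here refl)))))))
  e≡1 | inj₁ m1 with m≤n⇒m<n∨m≡n (proj₁ (π-range (∈-++⁺ʳ ρ (there (here refl)))))
  ... | inj₂ refl = ⊥-elim (ρ-disjoint m1 (there (here refl)))
  ... | inj₁ lt = ⊥-elim (proj₂ (proj₂ isAltAv-π) (∈-∷-⊑-++ (d ∷ e ∷ []) m1 (keep (keep done))) lt ed)

  ends-with-1 : ρ ++ d ∷ e ∷ [] ≡ (ρ ++ [ d ]) ++ [ 1 ]
  ends-with-1 = trans (cong (λ t → ρ ++ d ∷ t ∷ []) e≡1) (sym (++-assoc ρ [ d ] [ 1 ]))

  result : ∃ λ p → IsAltAv (length p) p × Even p × a ∷ rest ≡ appendOne p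
  result with decompose-appendOne (suc m + suc m) (ρ ++ [ d ]) (subst (IsAltAv _) ends-with-1 isAltAv-π)
  ... | p , gp , lp , eqp = p , gp , length-double⇒Even (suc m) p lp , trans eq (trans ends-with-1 eqp)

max∉glue-prefix : ∀ p q → IsAltAv (length p) p → IsAltAv (length q) q → Even p
  → suc (suc (length p + length q)) ∉ map (_+ suc (length q)) p ++ [ suc (length q) ]
max∉glue-prefix p q gp gq ev m with ∈-++⁻ (map (_+ suc (length q)) p) m
... | inj₁ a = <-irrefl refl (proj₂ (Glue.L-range p q gp gq ev a))
... | inj₂ (here e) = <-irrefl (sym e) (Glue.s<N p q gp gq ev)

glue-prefix : ∀ p q → glue p q
  ≡ (map (_+ suc (length q)) p ++ [ suc (length q) ]) ++ suc (suc (length p + length q)) ∷ q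
glue-prefix p q = sym (++-assoc (map (_+ suc (length q)) p) [ suc (length q) ] _)

glue-injective : ∀ p q p' q' → IsAltAv (length p) p → IsAltAv (length q) q → Even p → IsAltAv (length p') p'
  → IsAltAv (length q') q' → Even p' →
  glue p q ≡ glue p' q' → p ≡ p' × q ≡ q'
glue-injective p q p' q' gp gq ev gp' gq' ev' e with cong length e
... | le with trans (sym (Glue.length-glue p q gp gq ev)) (trans le (Glue.length-glue p' q' gp' gq' ev'))
... | eN with ++-∷-unique-split (map (_+ suc (length q)) p ++ [ suc (length q) ])
    (map (_+ suc (length q')) p' ++ [ suc (length q') ])
               (max∉glue-prefix p q gp gq ev)
                   (subst (λ t → t ∉ map (_+ suc (length q')) p' ++ [ suc (length q') ]) (sym eN)
                   (max∉glue-prefix p' q' gp' gq' ev'))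
               (trans (sym (glue-prefix p q))
                   (trans e (trans (glue-prefix p' q')
                   (cong (λ t → (map (_+ suc (length q')) p' ++ [ suc (length q') ]) ++ t ∷ q') (sym eN)))))
... | e1 , refl with LP.∷ʳ-injective _ _ e1
... | e2 , _ = LP.map-injective (λ {a} {b} x → +-cancelʳ-≡ _ a b x) e2 , refl

appendOne-injective : ∀ p p' → appendOne p ≡ appendOne p' → p ≡ p'
appendOne-injective p p' e = LP.map-injective (λ {a} {b} x → +-cancelʳ-≡ _ a b x) (proj₁ (LP.∷ʳ-injective _ _ e))


-- Counting

countᵇ-AltAv-odd : ∀ P m → countᵇ P (AltAv (suc (m + m))) ≡ countᵇ (λ p → P (appendOne p)) (AltAv (m + m))
countᵇ-AltAv-odd P m = trans (countᵇ-sameMembers P (unique-AltAv (suc (m + m)))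
    (unique-map⁺ (unique-AltAv (m + m)) (λ _ _ e → appendOne-injective _ _ e)) to from)
    (countᵇ-map P appendOne (AltAv (m + m)))
  where
  to : ∀ {z} → z ∈ AltAv (suc (m + m)) → z ∈ map appendOne (AltAv (m + m))
  to {z} zm with decompose-odd m z (∈-AltAv⁻ {suc (m + m)} zm)
  ... | p , gp , ev , refl = ∈-map⁺ appendOne (∈-AltAv⁺ {m + m} (subst (λ t → IsAltAv t p) lp gp))
    where
    lp : length p ≡ m + m
    lp = suc-injective (trans (trans (+-comm 1 (length p))
        (trans (cong (_+ 1) (sym (length-map (_+ 1) p))) (sym (length-++ (map (_+ 1) p)))))
        (∈-AltAv⇒length {suc (m + m)} zm))

  from : ∀ {z} → z ∈ map appendOne (AltAv (m + m)) → z ∈ AltAv (suc (m + m))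
  from zm with ∈-map⁻ appendOne zm
  ... | p , pm , refl = ∈-AltAv⁺ {suc (m + m)}
      (subst (λ t → IsAltAv (suc t) (appendOne p)) (∈-AltAv⇒length {m + m} pm)
      (appendOne-IsAltAv p (∈-AltAv⇒IsAltAv {m + m} pm) (∈-AltAv-double⇒Even {m} pm)))

module EvenSplit (m : ℕ) where
  rest-length : ℕ → ℕ
  rest-length i = (m ∸ i) + (m ∸ i)

  gluesWith : ℕ → List ℕ → List (List ℕ)
  gluesWith i p = map (glue p) (AltAv (rest-length i))

  block : ℕ → List (List ℕ)
  block i = concatMap (gluesWith i) (AltAv (i + i))

  glued : List (List ℕ)
  glued = concatMap block (upTo (suc m))

  ∈-block⁻ : ∀ {i z} → z ∈ block i → ∃₂ λ p q → p ∈ AltAv (i + i) × q ∈ AltAv (rest-length i) × z ≡ glue p q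
  ∈-block⁻ {i} {z} zm with find (∈-concatMap⁻ (gluesWith i) {xs = AltAv (i + i)} zm)
  ... | p , pm , zm2 with ∈-map⁻ (glue p) zm2
  ... | q , qm , e = p , q , pm , qm , e

  glue-injective-∈ : ∀ {i i' j j' p q p' q'} → p ∈ AltAv (i + i) → q ∈ AltAv j → p' ∈ AltAv (i' + i') → q' ∈ AltAv j'
    → glue p q ≡ glue p' q' → p ≡ p' × q ≡ q'
  glue-injective-∈ {i} {i'} {j} {j'} pm qm pm' qm' e = glue-injective _ _ _ _ (∈-AltAv⇒IsAltAv {i + i} pm)
      (∈-AltAv⇒IsAltAv {j} qm) (∈-AltAv-double⇒Even {i} pm) (∈-AltAv⇒IsAltAv {i' + i'} pm') (∈-AltAv⇒IsAltAv {j'} qm')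
      (∈-AltAv-double⇒Even {i'} pm') e

  unique-glued : Unique glued
  unique-glued = unique-concatMap block (UP.upTo⁺ (suc m))
    (λ {i} _ → unique-concatMap (gluesWith i) (unique-AltAv (i + i))
       (λ {p} pm → unique-map⁺ (unique-AltAv (rest-length i))
           (λ qm qm' e → proj₂ (glue-injective-∈ {i} {i} {rest-length i} {rest-length i} pm qm pm qm' e)))
       (λ {p} {p'} {z} pm pm' z1 z2 → same-p {i} pm pm' z1 z2))
    (λ {i} {i'} {z} _ _ z1 z2 → same-block z1 z2)
    where
    same-p : ∀ {i p p' z} → p ∈ AltAv (i + i) → p' ∈ AltAv (i + i) → z ∈ gluesWith i p → z ∈ gluesWith i p' → p ≡ p'
    same-p {i} {p} {p'} pm pm' z1 z2 with ∈-map⁻ (glue p) z1 | ∈-map⁻ (glue p') z2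
    ... | q , qm , refl | q' , qm' , e = proj₁
        (glue-injective-∈ {i} {i} {rest-length i} {rest-length i} pm qm pm' qm' e)
    same-block : ∀ {i i' z} → z ∈ block i → z ∈ block i' → i ≡ i'
    same-block {i} {i'} z1 z2 with ∈-block⁻ {i} z1 | ∈-block⁻ {i'} z2
    ... | p , q , pm , qm , refl | p' , q' , pm' , qm' , e with glue-injective-∈ {i} {i'} {rest-length i}
        {rest-length i'} pm qm pm' qm' e
    ... | refl , _ = double-injective i i' (trans (sym (∈-AltAv⇒length {i + i} pm)) (∈-AltAv⇒length {i' + i'} pm'))

  glued⊆AltAv : ∀ {z} → z ∈ glued → z ∈ AltAv (suc m + suc m)
  glued⊆AltAv zm with find (∈-concatMap⁻ block {xs = upTo (suc m)} zm)
  ... | i , im , zm2 with ∈-block⁻ {i} zm2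
  ... | p , q , pm , qm , refl = ∈-AltAv⁺ {suc m + suc m}
      (subst (λ t → IsAltAv t (glue p q)) length≡
      (glue-IsAltAv p q (∈-AltAv⇒IsAltAv {i + i} pm) (∈-AltAv⇒IsAltAv {rest-length i} qm) (∈-AltAv-double⇒Even {i} pm)))
    where
    i≤m : i ≤ m
    i≤m = ≤-pred (∈-upTo⁻ im)
    length≡ : suc (suc (length p + length q)) ≡ suc m + suc m
    length≡ = trans (cong₂ (λ a b → suc (suc (a + b))) (∈-AltAv⇒length {i + i} pm) (∈-AltAv⇒length {rest-length i} qm))
            (trans (cong (λ t → suc (suc t))
                (trans (interchange i i (m ∸ i) (m ∸ i)) (cong (λ t → t + t) (m+[n∸m]≡n i≤m)))) (suc-suc-double m))

  AltAv⊆glued : ∀ {z} → z ∈ AltAv (suc m + suc m) → z ∈ glued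
  AltAv⊆glued {z} zm with decompose-even (m + m) z
      (subst (λ t → IsAltAv t z) (sym (suc-suc-double m)) (∈-AltAv⁻ {suc m + suc m} zm))
  ... | p , q , gp , gq , evp , refl with Even⇒length-double evp
  ... | i , lpi with double-difference i (length q) m length-p+q
    where
    length-p+q : (i + i) + length q ≡ m + m
    length-p+q = suc-injective (suc-injective (trans (cong (λ t → suc (suc (t + length q))) (sym lpi))
             (trans (sym (Glue.length-glue p q gp gq evp))
                 (trans (∈-AltAv⇒length {suc m + suc m} zm) (sym (suc-suc-double m))))))
  ... | j , lq , eij = ∈-concatMap⁺ block (lose (∈-upTo⁺ (s≤s (subst (i ≤_) eij (m≤m+n i j))))
                         (∈-concatMap⁺ (gluesWith i) (lose (∈-AltAv⁺ {i + i} (subst (λ t → IsAltAv t p) lpi gp))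
                            (∈-map⁺ (glue p) (∈-AltAv⁺ {rest-length i}
                                (subst (λ t → IsAltAv t q) (trans lq (cong (λ t → t + t) j≡m∸i)) gq))))))
    where
    j≡m∸i : j ≡ m ∸ i
    j≡m∸i = sym (trans (cong (_∸ i) (sym eij)) (m+n∸m≡n i j))

  countᵇ-AltAv-even : ∀ P → countᵇ P (AltAv (suc m + suc m))
    ≡ sum (map (λ i → sum (map (λ p → countᵇ (λ q → P (glue p q)) (AltAv (rest-length i))) (AltAv (i + i))))
    (upTo (suc m)))
  countᵇ-AltAv-even P = trans (countᵇ-sameMembers P (unique-AltAv (suc m + suc m)) unique-glued AltAv⊆glued glued⊆AltAv)
    (trans (countᵇ-concatMap P block (upTo (suc m)))
      (cong sum (LP.map-cong (λ i → trans (countᵇ-concatMap P (gluesWith i) (AltAv (i + i)))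
          (cong sum (LP.map-cong (λ p → countᵇ-map P (glue p) (AltAv (rest-length i))) (AltAv (i + i)))))
              (upTo (suc m)))))

incs-appendOne : ∀ k p → IsAltAv (length p) p → incs (suc (suc k)) (appendOne p) ≡ incs (suc (suc k)) p
incs-appendOne k p gp = trans (incsAbove-++ nothing (suc k) (map (_+ 1) p) [ 1 ] cr)
    (trans (+-identityʳ _) (incsAbove-shift 1 nothing (suc (suc k)) p))
  where
  cr : ∀ {x y} → x ∈ map (_+ 1) p → y ∈ [ 1 ] → y < x
  cr xm (here refl) with ∈-map⁻ (_+ 1) xm
  ... | v , vm , refl = +-monoˡ-< 1 (proj₁ (All.lookup (proj₂ (proj₂ (proj₁ gp))) vm))

-- Both count permutations of length 2m, so their generating functions are series in y = x².
avoidCount : ℕ → ℕ → ℕ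
avoidCount k m = countᵇ (λ π → incs k π ≡ᵇ 0) (AltAv (m + m))

onceCount : ℕ → ℕ → ℕ
onceCount k m = countᵇ (λ π → incs k π ≡ᵇ 1) (AltAv (m + m))

module GlueCount (t : ℕ) (i j : ℕ) (p : List ℕ) (pm : p ∈ AltAv (i + i)) where
  k : ℕ
  k = 3 + t

  gp : IsAltAv (length p) p
  gp = ∈-AltAv⇒IsAltAv {i + i} pm

  evp : Even p
  evp = ∈-AltAv-double⇒Even {i} pm

  incs-glue-p : ∀ {q} → q ∈ AltAv j → incs k (glue p q) ≡ (incs k p + incs (2 + t) p) + incs k q
  incs-glue-p {q} qm = Glue.incs-glue-≥3 p q gp (∈-AltAv⇒IsAltAv {j} qm) evp t

  countᵇ-glue-avoid : countᵇ (λ q → incs k (glue p q) ≡ᵇ 0) (AltAv j)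
    ≡ (if incs (2 + t) p ≡ᵇ 0 then countᵇ (λ q → incs k q ≡ᵇ 0) (AltAv j) else 0)
  countᵇ-glue-avoid with incs (2 + t) p in e
  ... | zero = countᵇ-cong (AltAv j)
      (λ {q} qm → cong (_≡ᵇ 0) (trans (incs-glue-p qm)
      (cong₂ (λ a b → (a + b) + incs k q) (incsAbove-0-suc nothing (suc t) p e) e)))
  ... | suc b = countᵇ-none (AltAv j)
      (λ {q} qm → positive (incs k p) b (incs k q)
      (cong (_≡ᵇ 0) (trans (incs-glue-p qm) (cong (λ z → (incs k p + z) + incs k q) e))))
    where
    positive : ∀ a b c {x} → x ≡ (((a + suc b) + c) ≡ᵇ 0) → x ≡ false
    positive a b c e' rewrite +-suc a b = e'

  countᵇ-glue-once : countᵇ (λ q → incs k (glue p q) ≡ᵇ 1) (AltAv j) ≡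
           (if incs (2 + t) p ≡ᵇ 0 then countᵇ (λ q → incs k q ≡ᵇ 1) (AltAv j) else 0) +
               (if incs (2 + t) p ≡ᵇ 1 then countᵇ (λ q → incs k q ≡ᵇ 0) (AltAv j) else 0)
  countᵇ-glue-once with incs (2 + t) p in e
  ... | zero = trans (countᵇ-cong (AltAv j)
      (λ {q} qm → cong (_≡ᵇ 1) (trans (incs-glue-p qm)
      (cong₂ (λ a b → (a + b) + incs k q) (incsAbove-0-suc nothing (suc t) p e) e)))) (sym (+-identityʳ _))
  ... | suc zero = countᵇ-cong (AltAv j)
      (λ {q} qm → cong (_≡ᵇ 1) (trans (incs-glue-p qm)
      (cong₂ (λ a b → (a + b) + incs k q) (incsAbove-1-suc nothing (suc t) p e) e)))
  ... | suc (suc b) = countᵇ-none (AltAv j)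
      (λ {q} qm → ≥2 (incs k p) b (incs k q)
      (cong (_≡ᵇ 1) (trans (incs-glue-p qm) (cong (λ z → (incs k p + z) + incs k q) e))))
    where
    ≥2 : ∀ a b c {x} → x ≡ (((a + suc (suc b)) + c) ≡ᵇ 1) → x ≡ false
    ≥2 a b c e' rewrite +-suc a (suc b) | +-suc a b = e'

convolve : (ℕ → ℕ) → (ℕ → ℕ) → ℕ → ℕ
convolve F G m = sum (map (λ i → F i * G (m ∸ i)) (upTo (suc m)))

avoidCount-rec : ∀ t m → avoidCount (3 + t) (suc m) ≡ convolve (avoidCount (2 + t)) (avoidCount (3 + t)) m
avoidCount-rec t m = trans (EvenSplit.countᵇ-AltAv-even m (λ π → incs (3 + t) π ≡ᵇ 0))
  (sum-map-cong∈ _ _ (upTo (suc m)) (λ {i} _ →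
     trans (sum-map-cong∈ _ _ (AltAv (i + i))
         (λ {p} pm → GlueCount.countᵇ-glue-avoid t i (EvenSplit.rest-length m i) p pm))
           (sum-map-if (λ p → incs (2 + t) p ≡ᵇ 0) _ (AltAv (i + i)))))

onceCount-rec : ∀ t m → onceCount (3 + t) (suc m) ≡
  convolve (avoidCount (2 + t)) (onceCount (3 + t)) m + convolve (onceCount (2 + t)) (avoidCount (3 + t)) m
onceCount-rec t m = trans (EvenSplit.countᵇ-AltAv-even m (λ π → incs (3 + t) π ≡ᵇ 1))
  (trans (sum-map-cong∈ _ _ (upTo (suc m)) (λ {i} _ →
     trans (sum-map-cong∈ _ _ (AltAv (i + i))
         (λ {p} pm → GlueCount.countᵇ-glue-once t i (EvenSplit.rest-length m i) p pm))
       (trans (sum-map-+ (λ p → if incs (2 + t) p ≡ᵇ 0 then onceCount (3 + t) (m ∸ i) else 0)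
                         (λ p → if incs (2 + t) p ≡ᵇ 1 then avoidCount (3 + t) (m ∸ i) else 0) (AltAv (i + i)))
              (cong₂ _+_ (sum-map-if (λ p → incs (2 + t) p ≡ᵇ 0) _ (AltAv (i + i)))
                         (sum-map-if (λ p → incs (2 + t) p ≡ᵇ 1) _ (AltAv (i + i)))))))
    (sum-map-+ (λ i → avoidCount (2 + t) i * onceCount (3 + t) (m ∸ i))
               (λ i → onceCount (2 + t) i * avoidCount (3 + t) (m ∸ i)) (upTo (suc m))))

incs-2-glue : ∀ {i j p q} → p ∈ AltAv (i + i) → q ∈ AltAv j → incs 2 (glue p q) ≡ (incs 2 p + (incs 1 p + 1)) + incs 2 q
incs-2-glue {i} {j} {p} {q} pm qm = Glue.incs-glue-2 p q (∈-AltAv⇒IsAltAv {i + i} pm) (∈-AltAv⇒IsAltAv {j} qm)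
    (∈-AltAv-double⇒Even {i} pm)

avoidCount-2 : ∀ m → avoidCount 2 (suc m) ≡ 0
avoidCount-2 m = trans (EvenSplit.countᵇ-AltAv-even m (λ π → incs 2 π ≡ᵇ 0))
  (sum-map-zero _ (upTo (suc m)) (λ {i} _ → sum-map-zero _ (AltAv (i + i)) (λ {p} pm →
     countᵇ-none (AltAv (EvenSplit.rest-length m i))
         (λ {q} qm → trans (cong (_≡ᵇ 0) (incs-2-glue {i} {EvenSplit.rest-length m i} pm qm))
         (positive (incs 2 p) (incs 1 p) (incs 2 q))))))
  where
  positive : ∀ a b c → (((a + (b + 1)) + c) ≡ᵇ 0) ≡ false
  positive a b c rewrite +-comm b 1 | +-suc a b = refl

onceCount-2 : ∀ m → onceCount 2 (suc m) ≡ avoidCount 2 m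
onceCount-2 m = trans (EvenSplit.countᵇ-AltAv-even m (λ π → incs 2 π ≡ᵇ 1))
  (trans (cong₂ _+_ (trans (+-identityʳ _)
      (countᵇ-cong (AltAv (m + m)) (λ {q} qm → cong (_≡ᵇ 1)
      (Glue.incs-glue-2 [] q IsAltAv-[] (∈-AltAv⇒IsAltAv {m + m} qm) even[]))))
                    (sum-map-zero _ (applyUpTo suc m) (λ {x} xm → later-blocks-vanish x xm)))
         (+-identityʳ _))
  where
  ≥2 : ∀ a b c → (((a + (suc b + 1)) + c) ≡ᵇ 1) ≡ false
  ≥2 a b c rewrite +-comm b 1 | +-suc a (suc b) | +-suc a b = refl

  later-blocks-vanish : ∀ x → x ∈ applyUpTo suc m
    → sum (map (λ p → countᵇ (λ q → incs 2 (glue p q) ≡ᵇ 1) (AltAv (EvenSplit.rest-length m x))) (AltAv (x + x))) ≡ 0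
  later-blocks-vanish x xm with ∈-applyUpTo⁻ suc xm
  ... | i , _ , refl = sum-map-zero _ (AltAv (suc i + suc i)) (λ {p} pm →
       countᵇ-none (AltAv (EvenSplit.rest-length m (suc i)))
           (λ {q} qm → trans (cong (_≡ᵇ 1) (trans (incs-2-glue {suc i} {EvenSplit.rest-length m (suc i)} pm qm)
          (cong (λ w → (incs 2 p + (w + 1)) + incs 2 q) (trans (incs-1 p) (∈-AltAv⇒length {suc i + suc i} pm)))))
          (≥2 (incs 2 p) (i + suc i) (incs 2 q))))

a≡countᵇ-AltAv : ∀ k n → a k n ≡ countᵇ (λ π → incs k π ≡ᵇ 1) (AltAv n)
a≡countᵇ-AltAv k n = trans (countᵇ-cong (perms n)
    (λ {π} _ → sym (∧-assoc (altUp π) (occurrences pat132 π ≡ᵇ 0) (occurrences (increasing k) π ≡ᵇ 1))))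
  (trans (countᵇ-filterᵇ isAltAvᵇ (λ π → occurrences (increasing k) π ≡ᵇ 1) (perms n))
     (countᵇ-cong (AltAv n) (λ {π} _ → cong (_≡ᵇ 1) (occurrences-increasing k π))))

a-even : ∀ k m → a k (m + m) ≡ onceCount k m
a-even k m = a≡countᵇ-AltAv k (m + m)

a-odd : ∀ t m → a (2 + t) (suc (m + m)) ≡ onceCount (2 + t) m
a-odd t m = trans (a≡countᵇ-AltAv (2 + t) (suc (m + m)))
  (trans (countᵇ-AltAv-odd (λ π → incs (2 + t) π ≡ᵇ 1) m)
    (countᵇ-cong (AltAv (m + m)) (λ {p} pm → cong (_≡ᵇ 1) (incs-appendOne t p (∈-AltAv⇒IsAltAv {m + m} pm)))))


-- Power series

infix 4 _≈_

_≈_ : Series → Series → Set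
f ≈ g = ∀ n → f n ≡ g n

tail : Series → Series
tail f n = f (suc n)

-- The Cauchy product by recursion on the first factor; the ring laws are proved for it
-- and transferred to ⊛ by ⊛≈mul.
mul : Series → Series → Series
mul f g zero = f 0 ⊗ g 0
mul f g (suc n) = f 0 ⊗ g (suc n) ⊕ mul (tail f) g n

add sub : Series → Series → Series
add f g n = f n ⊕ g n
sub f g n = f n ⊖ g n

0ₛ 1ₛ : Series
0ₛ _ = + 0
1ₛ zero = + 1
1ₛ (suc _) = + 0

shift : Series → Series
shift f zero = + 0
shift f (suc n) = f n

map-applyUpTo-∘ : ∀ {A : Set} (h : ℕ → A) (G : ℕ → ℕ) m → map h (applyUpTo G m) ≡ applyUpTo (λ i → h (G i)) m
map-applyUpTo-∘ h G zero = refl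
map-applyUpTo-∘ h G (suc m) = cong (h (G 0) ∷_) (map-applyUpTo-∘ h (λ i → G (suc i)) m)

⊛≈mul : ∀ f g → (f ⊛ g) ≈ mul f g
⊛≈mul f g zero = ZP.+-identityʳ (f 0 ⊗ g 0)
⊛≈mul f g (suc n) = cong (f 0 ⊗ g (suc n) ⊕_)
    (trans (cong sumℤ (trans (map-applyUpTo-∘ (λ i → f i ⊗ g (suc n ∸ i)) suc (suc n))
    (sym (map-applyUpTo-∘ (λ i → f (suc i) ⊗ g (n ∸ i)) (λ i → i) (suc n))))) (⊛≈mul (tail f) g n))

mul-cong : ∀ {f f' g g'} → f ≈ f' → g ≈ g' → mul f g ≈ mul f' g'
mul-cong ef eg zero = cong₂ _⊗_ (ef 0) (eg 0)
mul-cong ef eg (suc n) = cong₂ _⊕_ (cong₂ _⊗_ (ef 0) (eg (suc n))) (mul-cong (λ m → ef (suc m)) eg n)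

mul-zeroˡ : ∀ f g → f ≈ 0ₛ → mul f g ≈ 0ₛ
mul-zeroˡ f g e zero rewrite e 0 = ZP.*-zeroˡ (g 0)
mul-zeroˡ f g e (suc n) rewrite e 0 = trans (cong (_⊕ mul (tail f) g n) (ZP.*-zeroˡ (g (suc n))))
    (trans (ZP.+-identityˡ _) (mul-zeroˡ (tail f) g (λ m → e (suc m)) n))

mul-oneˡ : ∀ f → mul 1ₛ f ≈ f
mul-oneˡ f zero = ZP.*-identityˡ (f 0)
mul-oneˡ f (suc n) = trans (cong₂ _⊕_ (ZP.*-identityˡ (f (suc n))) (mul-zeroˡ (tail 1ₛ) f (λ _ → refl) n))
    (ZP.+-identityʳ _)

mul-distribʳ : ∀ f g h → mul (add f g) h ≈ add (mul f h) (mul g h)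
mul-distribʳ f g h zero = ZP.*-distribʳ-+ (h 0) (f 0) (g 0)
mul-distribʳ f g h (suc n) rewrite mul-distribʳ (tail f) (tail g) h n =
  solve 5 (λ a b c x y → (a :+ b) :* c :+ (x :+ y) := (a :* c :+ x) :+ (b :* c :+ y)) refl (f 0) (g 0) (h (suc n))
      (mul (tail f) h n) (mul (tail g) h n)

mul-subʳ : ∀ f g h → mul (sub f g) h ≈ sub (mul f h) (mul g h)
mul-subʳ f g h zero = solve 3 (λ a b c → (a :- b) :* c := a :* c :- b :* c) refl (f 0) (g 0) (h 0)
mul-subʳ f g h (suc n) rewrite mul-subʳ (tail f) (tail g) h n =
  solve 5 (λ a b c x y → (a :- b) :* c :+ (x :- y) := (a :* c :+ x) :- (b :* c :+ y)) refl (f 0) (g 0) (h (suc n))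
      (mul (tail f) h n) (mul (tail g) h n)

mul-scaleˡ : ∀ c f g → mul (scale c f) g ≈ scale c (mul f g)
mul-scaleˡ c f g zero = ZP.*-assoc c (f 0) (g 0)
mul-scaleˡ c f g (suc n) rewrite mul-scaleˡ c (tail f) g n =
  solve 4 (λ c a b x → c :* a :* b :+ c :* x := c :* (a :* b :+ x)) refl c (f 0) (g (suc n)) (mul (tail f) g n)

mul-shiftˡ : ∀ f g → mul (shift f) g ≈ shift (mul f g)
mul-shiftˡ f g zero = ZP.*-zeroˡ (g 0)
mul-shiftˡ f g (suc n) = trans (cong (_⊕ mul f g n) (ZP.*-zeroˡ (g (suc n)))) (ZP.+-identityˡ _)

mul-comm : ∀ f g → mul f g ≈ mul g f
mul-comm f g zero = ZP.*-comm (f 0) (g 0)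
mul-comm f g (suc zero) = solve 4 (λ a b c d → a :* b :+ c :* d := d :* c :+ b :* a) refl (f 0) (g 1) (f 1) (g 0)
mul-comm f g (suc (suc n)) =
  trans (cong (f 0 ⊗ g (suc (suc n)) ⊕_)
      (trans (mul-comm (tail f) g (suc n)) (cong (g 0 ⊗ f (suc (suc n)) ⊕_) (mul-comm (tail g) (tail f) n))))
   (trans (solve 3 (λ a b x → a :+ (b :+ x) := b :+ (a :+ x)) refl (f 0 ⊗ g (suc (suc n))) (g 0 ⊗ f (suc (suc n)))
       (mul (tail f) (tail g) n))
     (cong (g 0 ⊗ f (suc (suc n)) ⊕_) (sym (mul-comm (tail g) f (suc n)))))

mul-assoc : ∀ f g h → mul (mul f g) h ≈ mul f (mul g h)
mul-assoc f g h zero = ZP.*-assoc (f 0) (g 0) (h 0)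
mul-assoc f g h (suc n) =
  trans (cong (f 0 ⊗ g 0 ⊗ h (suc n) ⊕_)
          (trans (mul-distribʳ (scale (f 0) (tail g)) (mul (tail f) g) h n)
                 (cong₂ _⊕_ (mul-scaleˡ (f 0) (tail g) h n) (mul-assoc (tail f) g h n))))
        (solve 5 (λ a b c x y → a :* b :* c :+ (a :* x :+ y) := a :* (b :* c :+ x) :+ y) refl
           (f 0) (g 0) (h (suc n)) (mul (tail g) h n) (mul (tail f) (mul g h) n))

≈-sym : ∀ {f g} → f ≈ g → g ≈ f
≈-sym e n = sym (e n)

≈-trans : ∀ {f g h} → f ≈ g → g ≈ h → f ≈ h
≈-trans e1 e2 n = trans (e1 n) (e2 n)

≈-setoid : Setoid _ _
≈-setoid = record
  { Carrier = Series
  ; _≈_ = _≈_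
  ; isEquivalence = record { refl = λ _ → refl ; sym = ≈-sym ; trans = ≈-trans }
  }

module ≈-Reasoning = Relation.Binary.Reasoning.Setoid ≈-setoid

shift-cong : ∀ {f g} → f ≈ g → shift f ≈ shift g
shift-cong e zero = refl
shift-cong e (suc n) = e n

sub-cong : ∀ {f f' g g'} → f ≈ f' → g ≈ g' → sub f g ≈ sub f' g'
sub-cong e1 e2 n = cong₂ _⊖_ (e1 n) (e2 n)

mul-congˡ : ∀ {f f'} g → f ≈ f' → mul f g ≈ mul f' g
mul-congˡ g e = mul-cong e (λ _ → refl)

mul-congʳ : ∀ f {g g'} → g ≈ g' → mul f g ≈ mul f g'
mul-congʳ f e = mul-cong (λ _ → refl) e

mul-scaleʳ : ∀ c f g → mul f (scale c g) ≈ scale c (mul f g)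
mul-scaleʳ c f g = ≈-trans (mul-comm f (scale c g)) (≈-trans (mul-scaleˡ c g f) (λ n → cong (c ⊗_) (mul-comm g f n)))

scale-cong : ∀ {c c' f g} → c ≡ c' → f ≈ g → scale c f ≈ scale c' g
scale-cong ec ef n = cong₂ _⊗_ ec (ef n)

scale-congʳ : ∀ c {f g} → f ≈ g → scale c f ≈ scale c g
scale-congʳ c = scale-cong {c} refl

scale-scale : ∀ c d f → scale c (scale d f) ≈ scale (c ⊗ d) f
scale-scale c d f n = sym (ZP.*-assoc c d (f n))

shift-xPow : ∀ r → shift (xPow r) ≈ xPow (suc r)
shift-xPow r zero = refl
shift-xPow r (suc n) = refl

shift-1ₛ : shift 1ₛ ≈ xPow 1
shift-1ₛ zero = refl
shift-1ₛ (suc zero) = refl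
shift-1ₛ (suc (suc n)) = refl

dilate : Series → Series
dilate f zero = f 0
dilate f (suc zero) = + 0
dilate f (suc (suc n)) = dilate (tail f) n

dilate-cong : ∀ {f g} → f ≈ g → dilate f ≈ dilate g
dilate-cong e zero = e 0
dilate-cong e (suc zero) = refl
dilate-cong e (suc (suc n)) = dilate-cong (λ m → e (suc m)) n

dilate-0ₛ : ∀ f → f ≈ 0ₛ → dilate f ≈ 0ₛ
dilate-0ₛ f e zero = e 0
dilate-0ₛ f e (suc zero) = refl
dilate-0ₛ f e (suc (suc n)) = dilate-0ₛ (tail f) (λ m → e (suc m)) n

dilate-add : ∀ f g → dilate (add f g) ≈ add (dilate f) (dilate g)
dilate-add f g zero = refl
dilate-add f g (suc zero) = refl
dilate-add f g (suc (suc n)) = dilate-add (tail f) (tail g) n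

dilate-scale : ∀ c f → dilate (scale c f) ≈ scale c (dilate f)
dilate-scale c f zero = refl
dilate-scale c f (suc zero) = sym (ZP.*-zeroʳ c)
dilate-scale c f (suc (suc n)) = dilate-scale c (tail f) n

dilate-sub : ∀ f g → dilate (sub f g) ≈ sub (dilate f) (dilate g)
dilate-sub f g zero = refl
dilate-sub f g (suc zero) = refl
dilate-sub f g (suc (suc n)) = dilate-sub (tail f) (tail g) n

dilate-shift : ∀ f → dilate (shift f) ≈ shift (shift (dilate f))
dilate-shift f zero = refl
dilate-shift f (suc zero) = refl
dilate-shift f (suc (suc n)) = refl

mul-dilate : ∀ f g → mul (dilate f) (dilate g) ≈ dilate (mul f g)
mul-dilate f g zero = refl
mul-dilate f g (suc zero) = trans (cong₂ _⊕_ (ZP.*-zeroʳ (f 0)) (ZP.*-zeroˡ (g 0))) refl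
mul-dilate f g (suc (suc n)) =
  trans (cong (f 0 ⊗ dilate (tail g) n ⊕_)
      (trans (cong (_⊕ mul (dilate (tail f)) (dilate g) n) (ZP.*-zeroˡ (dilate g (suc n))))
                                       (trans (ZP.+-identityˡ _) (mul-dilate (tail f) g n))))
        (sym (trans (dilate-add (scale (f 0) (tail g)) (mul (tail f) g) n)
            (cong (_⊕ dilate (mul (tail f) g) n) (dilate-scale (f 0) (tail g) n))))

dilate-xPow : ∀ r → dilate (xPow r) ≈ xPow (2 * r)
dilate-xPow zero zero = refl
dilate-xPow zero (suc zero) = refl
dilate-xPow zero (suc (suc n)) = dilate-0ₛ _ (λ _ → refl) n
dilate-xPow (suc r) = begin
    dilate (xPow (suc r))            ≈⟨ dilate-cong (≈-sym (shift-xPow r)) ⟩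
    dilate (shift (xPow r))             ≈⟨ dilate-shift (xPow r) ⟩
    shift (shift (dilate (xPow r)))  ≈⟨ shift-cong (shift-cong (dilate-xPow r)) ⟩
    shift (shift (xPow (2 * r)))     ≈⟨ shift-cong (shift-xPow (2 * r)) ⟩
    shift (xPow (suc (2 * r)))       ≈⟨ shift-xPow (suc (2 * r)) ⟩
    xPow (suc (suc (2 * r)))         ≈⟨ (λ n → cong (λ i → xPow i n) (sym (*-suc 2 r))) ⟩
    xPow (2 * suc r)                 ∎
  where open ≈-Reasoning

shift-scale : ∀ c f → shift (scale c f) ≈ scale c (shift f)
shift-scale c f zero = sym (ZP.*-zeroʳ c)
shift-scale c f (suc n) = refl

dilate-double : ∀ f m → dilate f (m + m) ≡ f m
dilate-double f zero = refl
dilate-double f (suc m) = trans (cong (λ i → dilate f (suc i)) (+-suc m m)) (dilate-double (tail f) m)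

dilate-suc-double : ∀ f m → dilate f (suc (m + m)) ≡ + 0
dilate-suc-double f zero = refl
dilate-suc-double f (suc m) = trans (cong (λ i → dilate f (suc (suc i))) (+-suc m m)) (dilate-suc-double (tail f) m)

shift-dilate-double : ∀ f m → shift (dilate f) (m + m) ≡ + 0
shift-dilate-double f zero = refl
shift-dilate-double f (suc m) = trans (cong (λ i → dilate f i) (+-suc m m)) (dilate-suc-double f m)

mul-onePlusX : ∀ h → mul onePlusX h ≈ add h (shift h)
mul-onePlusX h zero = trans (ZP.*-identityˡ (h 0)) (sym (ZP.+-identityʳ (h 0)))
mul-onePlusX h (suc n) = cong₂ _⊕_ (ZP.*-identityˡ (h (suc n))) (trans (mul-congˡ h tlone n) (mul-oneˡ h n))
  where
  tlone : tail onePlusX ≈ 1ₛ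
  tlone zero = refl
  tlone (suc _) = refl


-- Generating functions

AvoidGF OnceGF : ℕ → Series
AvoidGF k n = + avoidCount k n
OnceGF k n = + onceCount k n

-- Q r (x²) = x^r U_r(1/(2x)), see scaledChebU≈dilate-Q.
Q : ℕ → Series
Q zero = 1ₛ
Q (suc zero) = 1ₛ
Q (suc (suc r)) = sub (Q (suc r)) (shift (Q r))

+-sum : ∀ {A : Set} (h : A → ℕ) xs → + sum (map h xs) ≡ sumℤ (map (λ x → + h x) xs)
+-sum h [] = refl
+-sum h (x ∷ xs) = trans (ZP.pos-+ (h x) (sum (map h xs))) (cong (+ h x ⊕_) (+-sum h xs))

+-convolve : ∀ (F G : ℕ → ℕ) m → + convolve F G m ≡ mul (λ n → + F n) (λ n → + G n) m
+-convolve F G m = trans (+-sum (λ i → F i * G (m ∸ i)) (upTo (suc m)))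
  (trans (cong sumℤ (LP.map-cong (λ i → ZP.pos-* (F i) (G (m ∸ i))) (upTo (suc m))))
         (⊛≈mul (λ n → + F n) (λ n → + G n) m))

AvoidGF-rec : ∀ t → AvoidGF (3 + t) ≈ add 1ₛ (shift (mul (AvoidGF (2 + t)) (AvoidGF (3 + t))))
AvoidGF-rec t zero = refl
AvoidGF-rec t (suc m) = trans (cong +_ (avoidCount-rec t m))
  (trans (+-convolve (avoidCount (2 + t)) (avoidCount (3 + t)) m) (sym (ZP.+-identityˡ _)))

OnceGF-rec : ∀ t → OnceGF (3 + t)
  ≈ shift (add (mul (AvoidGF (2 + t)) (OnceGF (3 + t))) (mul (OnceGF (2 + t)) (AvoidGF (3 + t))))
OnceGF-rec t zero = refl
OnceGF-rec t (suc m) = trans (cong +_ (onceCount-rec t m))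
  (trans (ZP.pos-+ (convolve (avoidCount (2 + t)) (onceCount (3 + t)) m)
      (convolve (onceCount (2 + t)) (avoidCount (3 + t)) m))
         (cong₂ _⊕_ (+-convolve (avoidCount (2 + t)) (onceCount (3 + t)) m)
             (+-convolve (onceCount (2 + t)) (avoidCount (3 + t)) m)))

AvoidGF-2 : AvoidGF 2 ≈ 1ₛ
AvoidGF-2 zero = refl
AvoidGF-2 (suc m) = cong +_ (avoidCount-2 m)

OnceGF-2 : OnceGF 2 ≈ shift 1ₛ
OnceGF-2 zero = refl
OnceGF-2 (suc m) = trans (cong +_ (onceCount-2 m)) (AvoidGF-2 m)

1-xAvoidGF : ℕ → Series
1-xAvoidGF t = sub 1ₛ (shift (AvoidGF (2 + t)))

AvoidGF-inverse : ∀ t → mul (AvoidGF (3 + t)) (1-xAvoidGF t) ≈ 1ₛ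
AvoidGF-inverse t = begin
    mul aa (1-xAvoidGF t)                         ≈⟨ mul-comm aa (1-xAvoidGF t) ⟩
    mul (1-xAvoidGF t) aa                         ≈⟨ mul-subʳ 1ₛ (shift aa') aa ⟩
    sub (mul 1ₛ aa) (mul (shift aa') aa)    ≈⟨ sub-cong (mul-oneˡ aa) (mul-shiftˡ aa' aa) ⟩
    sub aa (shift (mul aa' aa))               ≈⟨ cancel-rec ⟩
    1ₛ ∎
  where
  open ≈-Reasoning
  aa = AvoidGF (3 + t)
  aa' = AvoidGF (2 + t)

  cancel-rec : sub aa (shift (mul aa' aa)) ≈ 1ₛ
  cancel-rec n = trans (cong (_⊖ shift (mul aa' aa) n) (AvoidGF-rec t n))
      (solve 2 (λ x y → (x :+ y) :- y := x) refl (1ₛ n) (shift (mul aa' aa) n))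

AvoidGF-Q : ∀ t → mul (AvoidGF (2 + t)) (Q (suc t)) ≈ Q t

Q-rec-1-xAvoidGF : ∀ t → Q (2 + t) ≈ mul (1-xAvoidGF t) (Q (suc t))
Q-rec-1-xAvoidGF t = begin
    sub Q1 (shift (Q t))                         ≈⟨ sub-cong {Q1} {Q1} (λ _ → refl) (shift-cong (≈-sym (AvoidGF-Q t))) ⟩
    sub Q1 (shift (mul aa' Q1))                   ≈⟨ sub-cong (≈-sym (mul-oneˡ Q1)) (≈-sym (mul-shiftˡ aa' Q1)) ⟩
    sub (mul 1ₛ Q1) (mul (shift aa') Q1)        ≈⟨ ≈-sym (mul-subʳ 1ₛ (shift aa') Q1) ⟩
    mul (1-xAvoidGF t) Q1 ∎
  where
  open ≈-Reasoning
  Q1 = Q (suc t)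
  aa' = AvoidGF (2 + t)
AvoidGF-Q zero = ≈-trans (mul-congˡ 1ₛ AvoidGF-2) (mul-oneˡ 1ₛ)
AvoidGF-Q (suc t) = begin
    mul aa (Q (2 + t))        ≈⟨ mul-congʳ aa (Q-rec-1-xAvoidGF t) ⟩
    mul aa (mul (1-xAvoidGF t) Q1)           ≈⟨ ≈-sym (mul-assoc aa (1-xAvoidGF t) Q1) ⟩
    mul (mul aa (1-xAvoidGF t)) Q1           ≈⟨ mul-congˡ Q1 (AvoidGF-inverse t) ⟩
    mul 1ₛ Q1                    ≈⟨ mul-oneˡ Q1 ⟩
    Q1 ∎
  where
  open ≈-Reasoning
  aa = AvoidGF (3 + t)
  Q1 = Q (suc t)

1-xAvoidGF-OnceGF : ∀ t → mul (1-xAvoidGF t) (OnceGF (3 + t)) ≈ shift (mul (OnceGF (2 + t)) (AvoidGF (3 + t)))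
1-xAvoidGF-OnceGF t = begin
    mul (1-xAvoidGF t) O                          ≈⟨ mul-subʳ 1ₛ (shift aa') O ⟩
    sub (mul 1ₛ O) (mul (shift aa') O)     ≈⟨ sub-cong (mul-oneˡ O) (mul-shiftˡ aa' O) ⟩
    sub O (shift (mul aa' O))                ≈⟨ cancel-rec ⟩
    shift (mul O' aa) ∎
  where
  open ≈-Reasoning
  O = OnceGF (3 + t)
  O' = OnceGF (2 + t)
  aa = AvoidGF (3 + t)
  aa' = AvoidGF (2 + t)

  cancel-rec : sub O (shift (mul aa' O)) ≈ shift (mul O' aa)
  cancel-rec zero rewrite OnceGF-rec t zero = refl
  cancel-rec (suc n) = trans (cong (_⊖ mul aa' O n) (OnceGF-rec t (suc n)))
      (solve 2 (λ x y → (x :+ y) :- x := y) refl (mul aa' O n) (mul O' aa n))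

OnceGF-Q² : ∀ t → mul (OnceGF (2 + t)) (mul (Q (suc t)) (Q (suc t))) ≈ xPow (suc t)
OnceGF-Q² zero = begin
    mul (OnceGF 2) (mul 1ₛ 1ₛ)     ≈⟨ mul-congˡ (mul 1ₛ 1ₛ) OnceGF-2 ⟩
    mul (shift 1ₛ) (mul 1ₛ 1ₛ)   ≈⟨ mul-shiftˡ 1ₛ (mul 1ₛ 1ₛ) ⟩
    shift (mul 1ₛ (mul 1ₛ 1ₛ))   ≈⟨ shift-cong (≈-trans (mul-oneˡ (mul 1ₛ 1ₛ)) (mul-oneˡ 1ₛ)) ⟩
    shift 1ₛ                          ≈⟨ shift-1ₛ ⟩
    xPow 1 ∎
  where open ≈-Reasoning
OnceGF-Q² (suc t) = begin
    mul O (mul Q2 Q2)                         ≈⟨ mul-congʳ O (mul-congˡ Q2 (Q-rec-1-xAvoidGF t)) ⟩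
    mul O (mul (mul (1-xAvoidGF t) Q1) Q2)            ≈⟨ mul-congʳ O (mul-assoc (1-xAvoidGF t) Q1 Q2) ⟩
    mul O (mul (1-xAvoidGF t) (mul Q1 Q2))            ≈⟨ ≈-sym (mul-assoc O (1-xAvoidGF t) (mul Q1 Q2)) ⟩
    mul (mul O (1-xAvoidGF t)) (mul Q1 Q2)            ≈⟨ mul-congˡ (mul Q1 Q2) (mul-comm O (1-xAvoidGF t)) ⟩
    mul (mul (1-xAvoidGF t) O) (mul Q1 Q2)            ≈⟨ mul-congˡ (mul Q1 Q2) (1-xAvoidGF-OnceGF t) ⟩
    mul (shift (mul O' aa)) (mul Q1 Q2)          ≈⟨ mul-shiftˡ (mul O' aa) (mul Q1 Q2) ⟩
    shift (mul (mul O' aa) (mul Q1 Q2))          ≈⟨ shift-cong (mul-assoc O' aa (mul Q1 Q2)) ⟩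
    shift (mul O' (mul aa (mul Q1 Q2)))          ≈⟨ shift-cong (mul-congʳ O' inner) ⟩
    shift (mul O' (mul Q1 Q1))                   ≈⟨ shift-cong (OnceGF-Q² t) ⟩
    shift (xPow (suc t))                         ≈⟨ shift-xPow (suc t) ⟩
    xPow (2 + t) ∎
  where
  open ≈-Reasoning
  O = OnceGF (3 + t)
  O' = OnceGF (2 + t)
  aa = AvoidGF (3 + t)
  Q1 = Q (suc t)
  Q2 = Q (2 + t)

  inner : mul aa (mul Q1 Q2) ≈ mul Q1 Q1
  inner = begin
    mul aa (mul Q1 Q2)     ≈⟨ mul-congʳ aa (mul-comm Q1 Q2) ⟩
    mul aa (mul Q2 Q1)     ≈⟨ ≈-sym (mul-assoc aa Q2 Q1) ⟩
    mul (mul aa Q2) Q1     ≈⟨ mul-congˡ Q1 (AvoidGF-Q (suc t)) ⟩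
    mul Q1 Q1 ∎

A≈dilate-OnceGF : ∀ t → A (3 + t) ≈ add (dilate (OnceGF (3 + t))) (shift (dilate (OnceGF (3 + t))))
A≈dilate-OnceGF t n with even-or-odd n
... | m , inj₁ refl = trans (cong +_ (a-even (3 + t) m))
        (sym (trans (cong₂ _⊕_ (dilate-double O m) (shift-dilate-double O m)) (ZP.+-identityʳ _)))
  where O = OnceGF (3 + t)
... | m , inj₂ refl = trans (cong +_ (a-odd (suc t) m))
        (sym (trans (cong₂ _⊕_ (dilate-suc-double O m) (dilate-double O m)) (ZP.+-identityˡ _)))
  where O = OnceGF (3 + t)

A≈onePlusX*dilate-OnceGF : ∀ t → A (3 + t) ≈ mul onePlusX (dilate (OnceGF (3 + t)))
A≈onePlusX*dilate-OnceGF t = ≈-trans (A≈dilate-OnceGF t) (≈-sym (mul-onePlusX (dilate (OnceGF (3 + t)))))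


-- Chebyshev polynomials

chebU-degree : ∀ r j → r < j → chebU r j ≡ + 0
chebU-degree zero (suc j) _ = refl
chebU-degree (suc zero) (suc zero) (s≤s ())
chebU-degree (suc zero) (suc (suc j)) _ = refl
chebU-degree (suc (suc r)) (suc j) (s≤s lt) rewrite chebU-degree (suc r) j lt | chebU-degree r (suc j)
    (<-trans (n<1+n r) (s≤s (<⇒≤ lt))) = refl

2^suc-suc : ∀ m → + (2 ^ suc (suc m)) ≡ + 2 ⊗ (+ 2 ⊗ + (2 ^ m))
2^suc-suc m = trans (ZP.pos-* 2 (2 * 2 ^ m)) (cong (+ 2 ⊗_) (ZP.pos-* 2 (2 ^ m)))

scaledChebU-rec : ∀ r → scaledChebU (suc (suc r))
  ≈ sub (scale (+ 2) (scaledChebU (suc r))) (scale (+ 4) (shift (shift (scaledChebU r))))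
scaledChebU-rec r zero rewrite chebU-degree r (suc (suc r)) (<-trans (n<1+n r) (n<1+n (suc r))) =
  solve 1 (λ x → (con (+ 2) :* x :- con (+ 0)) :* con (+ 1) := con (+ 2) :* (x :* con (+ 1)) :- con (+ 4) :* con (+ 0))
      refl (chebU (suc r) (suc r))
scaledChebU-rec r (suc zero) rewrite chebU-degree r (suc r) (n<1+n r) =
  solve 1 (λ x → (con (+ 2) :* x :- con (+ 0)) :* con (+ 2) := con (+ 2) :* (x :* con (+ 2)) :- con (+ 4) :* con (+ 0))
      refl (chebU (suc r) r)
scaledChebU-rec r (suc (suc m')) with <-cmp m' r
... | tri< lt _ _ = begin
    scaledChebU (suc (suc r)) (suc (suc m'))
      ≡⟨ if-true {b = m' <ᵇ suc r} (<ᵇ-true {m'} {suc r} (<-trans lt (n<1+n r))) ⟩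
    chebU (suc (suc r)) (r ∸ m') ⊗ + (2 ^ suc (suc m'))
      ≡⟨ cong₂ (λ j p → chebU (suc (suc r)) j ⊗ p) (∸-suc lt) (2^suc-suc m') ⟩
    (+ 2 ⊗ chebU (suc r) J ⊖ chebU r (suc J)) ⊗ (+ 2 ⊗ (+ 2 ⊗ W))
      ≡⟨ solve 3 (λ x y w → (con (+ 2) :* x :- y) :* (con (+ 2) :* (con (+ 2) :* w)) := con (+ 2) :*
          (x :* (con (+ 2) :* (con (+ 2) :* w))) :- con (+ 4) :* (y :* w)) refl
           (chebU (suc r) J) (chebU r (suc J)) W ⟩
    + 2 ⊗ (chebU (suc r) J ⊗ (+ 2 ⊗ (+ 2 ⊗ W))) ⊖ + 4 ⊗ (chebU r (suc J) ⊗ W)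
      ≡⟨ cong₂ (λ u v → + 2 ⊗ u ⊖ + 4 ⊗ v)
           (sym (trans (if-true {b = m' <ᵇ r} (<ᵇ-true {m'} {r} lt)) (cong (chebU (suc r) J ⊗_) (2^suc-suc m'))))
           (sym (trans (if-true {b = m' ≤ᵇ r} (≤ᵇ-true (<⇒≤ lt))) (cong (λ j → chebU r j ⊗ W) (∸-suc lt)))) ⟩
    sub (scale (+ 2) (scaledChebU (suc r))) (scale (+ 4) (shift (shift (scaledChebU r)))) (suc (suc m')) ∎
  where
  open ≡-Reasoning
  J = r ∸ suc m'
  W = + (2 ^ m')
... | tri≈ _ refl _ = begin
    scaledChebU (suc (suc m')) (suc (suc m'))
      ≡⟨ if-true {b = m' <ᵇ suc m'} (<ᵇ-true {m'} {suc m'} (n<1+n m')) ⟩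
    chebU (suc (suc m')) (m' ∸ m') ⊗ + (2 ^ suc (suc m'))
      ≡⟨ cong₂ (λ j p → chebU (suc (suc m')) j ⊗ p) (n∸n≡0 m') (2^suc-suc m') ⟩
    (+ 0 ⊖ chebU m' 0) ⊗ (+ 2 ⊗ (+ 2 ⊗ W))
      ≡⟨ solve 2 (λ y w → (con (+ 0) :- y) :* (con (+ 2) :* (con (+ 2) :* w)) := con (+ 2) :* con (+ 0) :- con (+ 4) :*
          (y :* w)) refl (chebU m' 0) W ⟩
    + 2 ⊗ + 0 ⊖ + 4 ⊗ (chebU m' 0 ⊗ W)
      ≡⟨ cong₂ (λ u v → + 2 ⊗ u ⊖ + 4 ⊗ v)
           (sym (if-false {b = m' <ᵇ m'} (<ᵇ-false {m'} {m'} ≤-refl)))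
           (sym (trans (if-true {b = m' ≤ᵇ m'} (≤ᵇ-true (≤-refl {m'}))) (cong (λ j → chebU m' j ⊗ W) (n∸n≡0 m')))) ⟩
    sub (scale (+ 2) (scaledChebU (suc m'))) (scale (+ 4) (shift (shift (scaledChebU m')))) (suc (suc m')) ∎
  where
  open ≡-Reasoning
  W = + (2 ^ m')
... | tri> _ _ m'>r rewrite <ᵇ-false {m'} {suc r} m'>r | <ᵇ-false {m'} {r} (<⇒≤ m'>r) | ≤ᵇ-false m'>r = refl

scaledChebU≈dilate-Q : ∀ r → scaledChebU r ≈ scale (+ (2 ^ r)) (dilate (Q r))
scaledChebU≈dilate-Q zero zero = refl
scaledChebU≈dilate-Q zero (suc zero) = refl
scaledChebU≈dilate-Q zero (suc (suc n)) = sym (trans (cong (+ 1 ⊗_) (dilate-0ₛ (tail 1ₛ) (λ _ → refl) n)) refl)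
scaledChebU≈dilate-Q (suc zero) zero = refl
scaledChebU≈dilate-Q (suc zero) (suc zero) = refl
scaledChebU≈dilate-Q (suc zero) (suc (suc n)) = sym (trans (cong (+ 2 ⊗_) (dilate-0ₛ (tail 1ₛ) (λ _ → refl) n)) refl)
scaledChebU≈dilate-Q (suc (suc r)) n =
  trans (scaledChebU-rec r n)
  (trans (cong₂ _⊖_ (cong (+ 2 ⊗_) (scaledChebU≈dilate-Q (suc r) n))
      (cong (+ 4 ⊗_) (≈-trans (shift-cong (shift-cong (scaledChebU≈dilate-Q r)))
      (≈-trans (shift-cong (shift-scale (+ (2 ^ r)) (dilate (Q r)))) (shift-scale (+ (2 ^ r)) (shift (dilate (Q r)))))
      n)))
  (trans (cong₂ (λ u v → + 2 ⊗ (u ⊗ dilate (Q (suc r)) n) ⊖ + 4 ⊗ (+ (2 ^ r) ⊗ v)) (ZP.pos-* 2 (2 ^ r))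
      (sym (dilate-shift (Q r) n)))
  (trans (solve 3 (λ w x y → con (+ 2) :* ((con (+ 2) :* w) :* x) :- con (+ 4) :* (w :* y) :=
      (con (+ 2) :* (con (+ 2) :* w)) :* (x :- y)) refl
            (+ (2 ^ r)) (dilate (Q (suc r)) n) (dilate (shift (Q r)) n))
  (cong₂ _⊗_ (sym (2^suc-suc r)) (sym (dilate-sub (Q (suc r)) (shift (Q r)) n))))))

scaledChebU² : ∀ r → mul (scaledChebU r) (scaledChebU r) ≈ scale (+ (4 ^ r)) (dilate (mul (Q r) (Q r)))
scaledChebU² r = begin
  mul (scaledChebU r) (scaledChebU r)                     ≈⟨ mul-cong (scaledChebU≈dilate-Q r)
      (scaledChebU≈dilate-Q r) ⟩
  mul (scale c (dilate (Q r))) (scale c (dilate (Q r)))   ≈⟨ mul-scaleˡ c (dilate (Q r)) (scale c (dilate (Q r))) ⟩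
  scale c (mul (dilate (Q r)) (scale c (dilate (Q r))))   ≈⟨ scale-congʳ c
      (mul-scaleʳ c (dilate (Q r)) (dilate (Q r))) ⟩
  scale c (scale c (mul (dilate (Q r)) (dilate (Q r))))   ≈⟨ scale-scale c c (mul (dilate (Q r)) (dilate (Q r))) ⟩
  scale (c ⊗ c) (mul (dilate (Q r)) (dilate (Q r)))       ≈⟨ scale-cong c⊗c≡4^r (mul-dilate (Q r) (Q r)) ⟩
  scale (+ (4 ^ r)) (dilate (mul (Q r) (Q r)))            ∎
  where
  open ≈-Reasoning
  c = + (2 ^ r)
  c⊗c≡4^r : c ⊗ c ≡ + (4 ^ r)
  c⊗c≡4^r = trans (sym (ZP.pos-* (2 ^ r) (2 ^ r))) (cong +_ (sym (4^≡2^*2^ r)))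

corollary3p2 : (k : ℕ) → 3 ≤ k → (n : ℕ) →
    (A k ⊛ (scaledChebU (k ∸ 1) ⊛ scaledChebU (k ∸ 1))) n
    ≡ scale (+ (4 ^ (k ∸ 1))) (onePlusX ⊛ xPow (2 * (k ∸ 1))) n
corollary3p2 k@(suc (suc (suc t))) (s≤s (s≤s (s≤s _))) = begin
  A k ⊛ (P ⊛ P)
    ≈⟨ ⊛≈mul (A k) (P ⊛ P) ⟩
  mul (A k) (P ⊛ P)
    ≈⟨ mul-cong (A≈onePlusX*dilate-OnceGF t) (≈-trans (⊛≈mul P P) (scaledChebU² r)) ⟩
  mul (mul onePlusX (dilate O)) (scale c (dilate QQ))
    ≈⟨ mul-scaleʳ c (mul onePlusX (dilate O)) (dilate QQ) ⟩
  scale c (mul (mul onePlusX (dilate O)) (dilate QQ))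
    ≈⟨ scale-congʳ c (mul-assoc onePlusX (dilate O) (dilate QQ)) ⟩
  scale c (mul onePlusX (mul (dilate O) (dilate QQ)))
    ≈⟨ scale-congʳ c (mul-congʳ onePlusX (mul-dilate O QQ)) ⟩
  scale c (mul onePlusX (dilate (mul O QQ)))
    ≈⟨ scale-congʳ c (mul-congʳ onePlusX (≈-trans (dilate-cong (OnceGF-Q² (suc t))) (dilate-xPow r))) ⟩
  scale c (mul onePlusX (xPow (2 * r)))
    ≈⟨ scale-congʳ c (≈-sym (⊛≈mul onePlusX (xPow (2 * r)))) ⟩
  scale c (onePlusX ⊛ xPow (2 * r)) ∎
  where
  open ≈-Reasoning
  r = 2 + t
  P = scaledChebU r
  O = OnceGF k
  QQ = mul (Q r) (Q r)
  c = + (4 ^ r)
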